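{- Let $P_n$ denote the path on $n$ vertices. Then $\lim_{n\to\infty}\mathcal{I}(P_n)=\frac{2r+2}{2r+3}$, where $r=\sqrt[3]{\frac{9+\sqrt{69}}{18}}+\sqrt[3]{\frac{9-\sqrt{69}}{18}}$ is the plastic number, the unique real root of $x^3=x+1$.
   Context: For a finite simple graph $G$: a matching is a set of pairwise vertex-disjoint edges; it is maximal if not contained in a larger matching. $\nu(G)$ is the maximum matching size, $\mathcal{T}_0(G)$ the number of maximal matchings, $\mathcal{T}_1(G)$ the sum of the sizes of all maximal matchings, and $\mathcal{I}(G)=\frac{\mathcal{T}_1(G)}{\nu(G)\mathcal{T}_0(G)}$ (equal to $1$ by convention if $\nu(G)=0$). -}

module Defs where

open import Data.Bool using (Bool; true; false; _∧_; _∨_; not; if_then_else_)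
open import Data.Nat as ℕ using (ℕ; zero; suc; _⊔_)
open import Data.Fin as Fin using (Fin; inject₁)
open import Data.Product using (_×_; _,_)
open import Data.List using (List; []; _∷_; map; length; filter; foldr; _++_)
open import Data.Nat.ListAction using (sum)
open import Data.Integer using (+_)
open import Data.Rational using (ℚ; 0ℚ; 1ℚ; _/_; _÷_; ≢-nonZero)
open import Data.Rational.Properties using (_≟_)
open import Relation.Nullary using (yes; no; does)

allB : {A : Set} → (A → Bool) → List A → Bool
allB p []       = true
allB p (x ∷ xs) = p x ∧ allB p xs

-- A finite simple graph on vertex set Fin n, given by its list of edges
-- (each edge an unordered pair {u,v}, u ≠ v, listed once).
record Graph : Set where
  field
    nV    : ℕ
    edges : List (Fin nV × Fin nV)
open Graph public

sublists : {A : Set} → List A → List (List A)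
sublists []       = [] ∷ []
sublists (x ∷ xs) = let r = sublists xs in map (x ∷_) r ++ r

module _ {n : ℕ} where
  _=ᵛ_ : Fin n → Fin n → Bool
  u =ᵛ v = does (u Fin.≟ v)

  meet : Fin n × Fin n → Fin n × Fin n → Bool
  meet (a , b) (c , d) = (a =ᵛ c) ∨ (a =ᵛ d) ∨ (b =ᵛ c) ∨ (b =ᵛ d)

  isMatching : List (Fin n × Fin n) → Bool
  isMatching []       = true
  isMatching (e ∷ es) = allB (λ f → not (meet e f)) es ∧ isMatching es

matchings : (G : Graph) → List (List (Fin (nV G) × Fin (nV G)))
matchings G = filter (λ M → isMatching M Data.Bool.≟ true) (sublists (edges G))
  where import Data.Bool

-- maximal: a matching M such that no edge e of G can be added, i.e. M ∪ {e}
-- is never a matching (for e ∈ M, e meets itself); equivalently M is not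
-- contained in a larger matching.
isMaximal : (G : Graph) → List (Fin (nV G) × Fin (nV G)) → Bool
isMaximal G M = isMatching M ∧ allB (λ e → not (isMatching (e ∷ M))) (edges G)

maximalMatchings : (G : Graph) → List (List (Fin (nV G) × Fin (nV G)))
maximalMatchings G = filter (λ M → isMaximal G M Data.Bool.≟ true) (sublists (edges G))
  where import Data.Bool

ν : Graph → ℕ
ν G = foldr _⊔_ 0 (map length (matchings G))

𝒯₀ : Graph → ℕ
𝒯₀ G = length (maximalMatchings G)

𝒯₁ : Graph → ℕ
𝒯₁ G = sum (map length (maximalMatchings G))

-- ℐ(G) = 𝒯₁ / (ν 𝒯₀), and 1 if ν = 0.  (When ν > 0 we always have 𝒯₀ ≥ 1;
-- the branch 𝒯₀ = 0 is unreachable and given the value 1 only for totality.)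
ℐ : Graph → ℚ
ℐ G with ν G | 𝒯₀ G
... | zero  | _     = 1ℚ
... | suc v | zero  = 1ℚ
... | suc v | suc t = (+ 𝒯₁ G) / (suc v ℕ.* suc t)

pathEdges : (n : ℕ) → List (Fin n × Fin n)
pathEdges zero          = []
pathEdges (suc zero)    = []
pathEdges (suc (suc n)) = (Fin.zero , Fin.suc Fin.zero)
                          ∷ map (λ { (a , b) → (Fin.suc a , Fin.suc b) }) (pathEdges (suc n))

P : ℕ → Graph
P n = record { nV = n ; edges = pathEdges n }

-- total division on ℚ (value 0 when dividing by 0; only used with nonzero divisors)
_÷'_ : ℚ → ℚ → ℚ
p ÷' q with q ≟ 0ℚ
... | yes _  = 0ℚ
... | no q≢0 = _÷_ p q {{≢-nonZero q≢0}}

-- the map x ↦ (2x+2)/(2x+3), continuous and strictly increasing on x ≥ 0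
limitMap : ℚ → ℚ
limitMap x = ((+ 2 / 1) Data.Rational.* x Data.Rational.+ (+ 2 / 1))
             ÷' ((+ 2 / 1) Data.Rational.* x Data.Rational.+ (+ 3 / 1))
  where import Data.Rational

{-# OPTIONS --safe #-}
module Submission where

-- Write A k and B k for 𝒯₀ and 𝒯₁ of the path with k edges. Splitting the maximal matchings
-- by the first edge gives A (k + 3) = A (k + 1) + A k and
-- B (k + 3) = (B (k + 1) + A (k + 1)) + (B k + A k), while ν = ⌈ k / 2 ⌉. The determinants
-- A k A (k + 2) - A (k + 1)² grow more slowly than A k², hence so does x² (x + y) - y³ for
-- x = A (k + 1), y = A (k + 2); this eventually pins y / x between any two rationals enclosing
-- the plastic number r. Comparing the recurrences of B k and k A k then gives
-- B k / (k A k) → (r + 1) / (2 r + 3), i.e. ℐ → (2 r + 2) / (2 r + 3). Everything is done in ℕ: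
-- p / d < r reads p³ < p d² + d³, and strict bounds come from an intermediate rational closer
-- to r.

module Padovan where

  open import Data.Nat using (ℕ; suc; _+_)

  A : ℕ → ℕ
  A 0 = 1
  A 1 = 1
  A 2 = 2
  A (suc (suc (suc k))) = A (suc k) + A k

  B : ℕ → ℕ
  B 0 = 0
  B 1 = 1
  B 2 = 2
  B (suc (suc (suc k))) = (B (suc k) + A (suc k)) + (B k + A k)

module SubsetSizes where

  open import Data.Bool using (Bool; true; false)
  open import Data.Bool.Properties using (_≟_)
  open import Data.Empty using (⊥-elim)
  open import Data.List using (List; []; _∷_; map; filter; length; foldr; _++_)
  open import Data.List.Properties using (filter-++; filter-≐; map-++; map-∘; length-map)
  open import Data.Nat using (ℕ; suc; _+_; _⊔_)
  open import Data.Nat.Properties using (+-assoc; +-suc; ⊔-assoc; ⊔-identityʳ)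
  open import Data.Nat.ListAction using (sum)
  open import Data.Product using (_,_)
  open import Function using (_∘_)
  open import Relation.Binary.PropositionalEquality
  open import Defs using (sublists)

  private variable
    X Y : Set

  sizesOf : (List X → Bool) → List (List X) → List ℕ
  sizesOf p S = map length (filter (λ M → p M ≟ true) S)

  sizesOf-++ : (p : List X → Bool) (S T : List (List X)) →
               sizesOf p (S ++ T) ≡ sizesOf p S ++ sizesOf p T
  sizesOf-++ p S T = trans (cong (map length) (filter-++ P? S T)) (map-++ length (filter P? S) (filter P? T))
    where P? = λ M → p M ≟ true

  sizesOf-map-∷ : (p : List X → Bool) (x : X) (S : List (List X)) →
                  sizesOf p (map (x ∷_) S) ≡ map suc (sizesOf (p ∘ (x ∷_)) S)
  sizesOf-map-∷ p x [] = refl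
  sizesOf-map-∷ p x (M ∷ S) with p (x ∷ M)
  ... | true  = cong (suc (length M) ∷_) (sizesOf-map-∷ p x S)
  ... | false = sizesOf-map-∷ p x S

  sizesOf-map-map : (p : List Y → Bool) (f : X → Y) (S : List (List X)) →
                    sizesOf p (map (map f) S) ≡ sizesOf (p ∘ map f) S
  sizesOf-map-map p f [] = refl
  sizesOf-map-map p f (M ∷ S) with p (map f M)
  ... | true  = cong₂ _∷_ (length-map f M) (sizesOf-map-map p f S)
  ... | false = sizesOf-map-map p f S

  sizesOf-cong : {p q : List X → Bool} → (∀ M → p M ≡ q M) → (S : List (List X)) →
                 sizesOf p S ≡ sizesOf q S
  sizesOf-cong p≗q S = cong (map length)
    (filter-≐ _ _ ((λ {M} → trans (sym (p≗q M))) , (λ {M} → trans (p≗q M))) S)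

  sizesOf-false : (S : List (List X)) → sizesOf (λ _ → false) S ≡ []
  sizesOf-false []      = refl
  sizesOf-false (M ∷ S) = sizesOf-false S

  sum-map-suc : (xs : List ℕ) → sum (map suc xs) ≡ sum xs + length xs
  sum-map-suc []       = refl
  sum-map-suc (x ∷ xs) = begin
    suc x + sum (map suc xs)      ≡⟨ cong (suc x +_) (sum-map-suc xs) ⟩
    suc (x + (sum xs + length xs)) ≡⟨ cong suc (+-assoc x (sum xs) (length xs)) ⟨
    suc (x + sum xs + length xs)   ≡⟨ +-suc (x + sum xs) (length xs) ⟨
    x + sum xs + suc (length xs)   ∎
    where open ≡-Reasoning

  maximum : List ℕ → ℕ
  maximum = foldr _⊔_ 0

  maximum-++ : (xs ys : List ℕ) → maximum (xs ++ ys) ≡ maximum xs ⊔ maximum ys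
  maximum-++ []       ys = refl
  maximum-++ (x ∷ xs) ys = trans (cong (x ⊔_) (maximum-++ xs ys)) (sym (⊔-assoc x (maximum xs) (maximum ys)))

  maximum-map-suc : (xs : List ℕ) → xs ≢ [] → maximum (map suc xs) ≡ suc (maximum xs)
  maximum-map-suc []           xs≢[] = ⊥-elim (xs≢[] refl)
  maximum-map-suc (x ∷ [])     _     = cong suc (sym (⊔-identityʳ x))
  maximum-map-suc (x ∷ y ∷ ys) _     = cong (suc x ⊔_) (maximum-map-suc (y ∷ ys) (λ ()))

  sublists-map : (f : X → Y) (xs : List X) → sublists (map f xs) ≡ map (map f) (sublists xs)
  sublists-map f [] = refl
  sublists-map f (x ∷ xs) = begin
    map (f x ∷_) (sublists (map f xs)) ++ sublists (map f xs)
      ≡⟨ cong (λ T → map (f x ∷_) T ++ T) (sublists-map f xs) ⟩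
    map (f x ∷_) (map (map f) S) ++ map (map f) S
      ≡⟨ cong (_++ map (map f) S) (trans (sym (map-∘ S)) (map-∘ S)) ⟩
    map (map f) (map (x ∷_) S) ++ map (map f) S
      ≡⟨ map-++ (map f) (map (x ∷_) S) S ⟨
    map (map f) (map (x ∷_) S ++ S) ∎
    where
    open ≡-Reasoning
    S = sublists xs

module PathMatchings where

  open import Defs
  open Padovan
  open SubsetSizes
  open import Data.Bool using (Bool; true; false; _∧_; _∨_; not)
  open import Data.Fin using (Fin; zero; suc)
  open import Data.List using (List; []; _∷_; map; length; _++_)
  open import Data.List.Properties using (map-cong; length-map; length-++; ++-identityʳ; ++-conicalʳ)
  open import Data.Nat using (ℕ; suc; _+_; _⊔_; ⌈_/2⌉; s≤s)
  open import Data.Nat.Properties using (m≥n⇒m⊔n≡m; ⌊n/2⌋≤⌈n/2⌉)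
  open import Data.Nat.ListAction using (sum)
  open import Data.Nat.ListAction.Properties using (sum-++)
  open import Data.Product using (_×_; _,_)
  open import Function using (_∘_)
  open import Relation.Binary.PropositionalEquality

  Edge : ℕ → Set
  Edge n = Fin n × Fin n

  module _ {n : ℕ} where

    shift : Edge n → Edge (suc n)
    shift (a , b) = suc a , suc b

    firstEdge : Edge (suc (suc n))
    firstEdge = zero , suc zero

    touches₀ : Edge (suc n) → Bool
    touches₀ (a , b) = (a =ᵛ zero) ∨ (b =ᵛ zero)

    covers₀ : List (Edge (suc n)) → Bool
    covers₀ []      = false
    covers₀ (e ∷ M) = touches₀ e ∨ covers₀ M

  pathEdges-suc : (n : ℕ) → pathEdges (suc (suc n)) ≡ firstEdge ∷ map shift (pathEdges (suc n))
  pathEdges-suc n = cong (firstEdge ∷_) (map-cong (λ _ → refl) (pathEdges (suc n)))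

  pathSizes : (n : ℕ) → (List (Edge n) → Bool) → List ℕ
  pathSizes n p = sizesOf p (sublists (pathEdges n))

  pathSizes-suc : (n : ℕ) {p : List (Edge (suc (suc n))) → Bool} {q r : List (Edge (suc n)) → Bool} →
                  (∀ M → p (firstEdge ∷ map shift M) ≡ q M) → (∀ M → p (map shift M) ≡ r M) →
                  pathSizes (suc (suc n)) p ≡ map suc (pathSizes (suc n) q) ++ pathSizes (suc n) r
  pathSizes-suc n {p} {q} {r} p-first p-shift = begin
    sizesOf p (sublists (pathEdges (suc (suc n))))
      ≡⟨ cong (sizesOf p ∘ sublists) (pathEdges-suc n) ⟩
    sizesOf p (map (firstEdge ∷_) S′ ++ S′)
      ≡⟨ sizesOf-++ p (map (firstEdge ∷_) S′) S′ ⟩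
    sizesOf p (map (firstEdge ∷_) S′) ++ sizesOf p S′
      ≡⟨ cong (_++ sizesOf p S′) (sizesOf-map-∷ p firstEdge S′) ⟩
    map suc (sizesOf (p ∘ (firstEdge ∷_)) S′) ++ sizesOf p S′
      ≡⟨ cong (λ T → map suc (sizesOf (p ∘ (firstEdge ∷_)) T) ++ sizesOf p T) (sublists-map shift E) ⟩
    map suc (sizesOf (p ∘ (firstEdge ∷_)) (map (map shift) S)) ++ sizesOf p (map (map shift) S)
      ≡⟨ cong₂ (λ T U → map suc T ++ U) (sizesOf-map-map (p ∘ (firstEdge ∷_)) shift S) (sizesOf-map-map p shift S) ⟩
    map suc (sizesOf (λ M → p (firstEdge ∷ map shift M)) S) ++ sizesOf (p ∘ map shift) S
      ≡⟨ cong₂ (λ T U → map suc T ++ U) (sizesOf-cong p-first S) (sizesOf-cong p-shift S) ⟩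
    map suc (pathSizes (suc n) q) ++ pathSizes (suc n) r ∎
    where
    open ≡-Reasoning
    E = pathEdges (suc n)
    S = sublists E
    S′ = sublists (map shift E)

  allB-map : {X Y : Set} (p : Y → Bool) (f : X → Y) (xs : List X) → allB p (map f xs) ≡ allB (p ∘ f) xs
  allB-map p f []       = refl
  allB-map p f (x ∷ xs) = cong (p (f x) ∧_) (allB-map p f xs)

  allB-cong : {X : Set} {p q : X → Bool} → (∀ x → p x ≡ q x) → (xs : List X) → allB p xs ≡ allB q xs
  allB-cong p≗q []       = refl
  allB-cong p≗q (x ∷ xs) = cong₂ _∧_ (p≗q x) (allB-cong p≗q xs)

  blocked : {n : ℕ} → List (Edge n) → Edge n → Bool
  blocked M e = not (isMatching (e ∷ M))

  isMatchingAvoiding₀ : {n : ℕ} → List (Edge (suc n)) → Bool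
  isMatchingAvoiding₀ M = not (covers₀ M) ∧ isMatching M

  isMaximalCovering₀ : (n : ℕ) → List (Edge (suc n)) → Bool
  isMaximalCovering₀ n M = covers₀ M ∧ isMaximal (P (suc n)) M

  -- M avoids vertex 0 and is a maximal matching of the path with vertex 0 deleted.
  isMaximalAvoiding₀ : (n : ℕ) → List (Edge (suc n)) → Bool
  isMaximalAvoiding₀ n M =
    not (covers₀ M) ∧ isMatching M ∧ allB (λ e → touches₀ e ∨ blocked M e) (pathEdges (suc n))

  isMatching-shift : {n : ℕ} (M : List (Edge n)) → isMatching (map shift M) ≡ isMatching M
  isMatching-shift []      = refl
  isMatching-shift (e ∷ M) = cong₂ _∧_ (allB-map (λ f → not (meet (shift e) f)) shift M) (isMatching-shift M)

  module _ {n : ℕ} where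

    covers₀-shift : (M : List (Edge (suc n))) → covers₀ (map shift M) ≡ false
    covers₀-shift []      = refl
    covers₀-shift (e ∷ M) = covers₀-shift M

    meet-first-shift : (g : Edge (suc n)) → meet firstEdge (shift g) ≡ touches₀ g
    meet-first-shift (zero  , zero)  = refl
    meet-first-shift (zero  , suc b) = refl
    meet-first-shift (suc a , zero)  = refl
    meet-first-shift (suc a , suc b) = refl

    allB-not-touches₀ : (M : List (Edge (suc n))) → allB (not ∘ touches₀) M ≡ not (covers₀ M)
    allB-not-touches₀ []      = refl
    allB-not-touches₀ (e ∷ M) with touches₀ e
    ... | true  = refl
    ... | false = allB-not-touches₀ M

    isMatching-first : (M : List (Edge (suc n))) →
                       isMatching (firstEdge ∷ map shift M) ≡ isMatchingAvoiding₀ M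
    isMatching-first M = cong₂ _∧_
      (begin
        allB (λ f → not (meet firstEdge f)) (map shift M) ≡⟨ allB-map _ shift M ⟩
        allB (λ g → not (meet firstEdge (shift g))) M     ≡⟨ allB-cong (cong not ∘ meet-first-shift) M ⟩
        allB (not ∘ touches₀) M                           ≡⟨ allB-not-touches₀ M ⟩
        not (covers₀ M)                                   ∎)
      (isMatching-shift M)
      where open ≡-Reasoning

    isMatching-shift-first : (g : Edge (suc n)) (M : List (Edge (suc n))) →
      isMatching (shift g ∷ firstEdge ∷ map shift M)
        ≡ (not (touches₀ g) ∧ allB (λ f → not (meet g f)) M) ∧ isMatchingAvoiding₀ M
    isMatching-shift-first g M =
      cong₂ _∧_ (cong (not (touches₀ g) ∧_) (allB-map (λ f → not (meet (shift g) f)) shift M)) (isMatching-first M)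

    isMaximal-first : (M : List (Edge (suc n))) →
                      isMaximal (P (suc (suc n))) (firstEdge ∷ map shift M) ≡ isMaximalAvoiding₀ n M
    isMaximal-first M = begin
      isMaximal (P (suc (suc n))) M′
        ≡⟨ cong (λ E′ → isMatching M′ ∧ allB (blocked M′) E′) (pathEdges-suc n) ⟩
      isMatching M′ ∧ allB (blocked M′) (map shift E)
        ≡⟨ cong₂ _∧_ (isMatching-first M)
                     (trans (allB-map (blocked M′) shift E) (allB-cong (λ g → cong not (isMatching-shift-first g M)) E)) ⟩
      isMatchingAvoiding₀ M ∧ allB (λ g → not ((not (touches₀ g) ∧ free g) ∧ isMatchingAvoiding₀ M)) E
        ≡⟨ reorder (covers₀ M) (isMatching M) ⟩
      isMaximalAvoiding₀ n M ∎
      where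
      open ≡-Reasoning
      M′ = firstEdge ∷ map shift M
      E = pathEdges (suc n)
      free : Edge (suc n) → Bool
      free g = allB (λ f → not (meet g f)) M
      reorder : ∀ c m → (not c ∧ m) ∧ allB (λ g → not ((not (touches₀ g) ∧ free g) ∧ (not c ∧ m))) E
                        ≡ not c ∧ m ∧ allB (λ g → touches₀ g ∨ not (free g ∧ m)) E
      reorder true  m     = refl
      reorder false false = refl
      reorder false true  = allB-cong (λ g → pointwise (touches₀ g) (free g)) E
        where
        pointwise : ∀ t y → not ((not t ∧ y) ∧ true) ≡ t ∨ not (y ∧ true)
        pointwise true  y = refl
        pointwise false y = refl

    isMaximal-shift : (M : List (Edge (suc n))) →
                      isMaximal (P (suc (suc n))) (map shift M) ≡ isMaximalCovering₀ n M
    isMaximal-shift M = begin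
      isMaximal (P (suc (suc n))) M′
        ≡⟨ cong (λ E′ → isMatching M′ ∧ allB (blocked M′) E′) (pathEdges-suc n) ⟩
      isMatching M′ ∧ (not (isMatching (firstEdge ∷ M′)) ∧ allB (blocked M′) (map shift E))
        ≡⟨ cong₂ (λ m x → m ∧ (not x ∧ allB (blocked M′) (map shift E))) (isMatching-shift M) (isMatching-first M) ⟩
      isMatching M ∧ (not (isMatchingAvoiding₀ M) ∧ allB (blocked M′) (map shift E))
        ≡⟨ cong (λ x → isMatching M ∧ (not (isMatchingAvoiding₀ M) ∧ x))
                (trans (allB-map (blocked M′) shift E) (allB-cong (λ g → cong not (isMatching-shift (g ∷ M))) E)) ⟩
      isMatching M ∧ (not (isMatchingAvoiding₀ M) ∧ allB (blocked M) E)
        ≡⟨ reorder (covers₀ M) (isMatching M) ⟩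
      isMaximalCovering₀ n M ∎
      where
      open ≡-Reasoning
      M′ = map shift M
      E = pathEdges (suc n)
      reorder : ∀ c m → m ∧ (not (not c ∧ m) ∧ allB (blocked M) E) ≡ c ∧ m ∧ allB (blocked M) E
      reorder true  m     = refl
      reorder false true  = refl
      reorder false false = refl

    isMaximalAvoiding₀-shift : (M : List (Edge (suc n))) →
                               isMaximalAvoiding₀ (suc n) (map shift M) ≡ isMaximal (P (suc n)) M
    isMaximalAvoiding₀-shift M = begin
      isMaximalAvoiding₀ (suc n) M′
        ≡⟨ cong₂ (λ c E′ → not c ∧ isMatching M′ ∧ allB (λ e → touches₀ e ∨ blocked M′ e) E′)
                 (covers₀-shift M) (pathEdges-suc n) ⟩
      isMatching M′ ∧ allB (λ e → touches₀ e ∨ blocked M′ e) (map shift E)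
        ≡⟨ cong₂ _∧_ (isMatching-shift M)
                     (trans (allB-map _ shift E) (allB-cong (λ g → cong not (isMatching-shift (g ∷ M))) E)) ⟩
      isMaximal (P (suc n)) M ∎
      where
      open ≡-Reasoning
      M′ = map shift M
      E = pathEdges (suc n)

  maximalSizes coveringSizes avoidingSizes matchingSizes avoidingMatchingSizes : ℕ → List ℕ
  maximalSizes k          = pathSizes (suc k) (isMaximal (P (suc k)))
  coveringSizes k         = pathSizes (suc k) (isMaximalCovering₀ k)
  avoidingSizes k         = pathSizes (suc k) (isMaximalAvoiding₀ k)
  matchingSizes k         = pathSizes (suc k) isMatching
  avoidingMatchingSizes k = pathSizes (suc k) isMatchingAvoiding₀

  maximalSizes-suc : ∀ k → maximalSizes (suc k) ≡ map suc (avoidingSizes k) ++ coveringSizes k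
  maximalSizes-suc k = pathSizes-suc k isMaximal-first isMaximal-shift

  coveringSizes-suc : ∀ k → coveringSizes (suc k) ≡ map suc (avoidingSizes k)
  coveringSizes-suc k = begin
    coveringSizes (suc k)
      ≡⟨ pathSizes-suc k isMaximal-first (λ M → cong (_∧ isMaximal (P (suc (suc k))) (map shift M)) (covers₀-shift M)) ⟩
    map suc (avoidingSizes k) ++ pathSizes (suc k) (λ _ → false)
      ≡⟨ cong (map suc (avoidingSizes k) ++_) (sizesOf-false (sublists (pathEdges (suc k)))) ⟩
    map suc (avoidingSizes k) ++ []
      ≡⟨ ++-identityʳ _ ⟩
    map suc (avoidingSizes k) ∎
    where open ≡-Reasoning

  avoidingSizes-suc : ∀ k → avoidingSizes (suc k) ≡ maximalSizes k
  avoidingSizes-suc k =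
    trans (pathSizes-suc k (λ _ → refl) isMaximalAvoiding₀-shift)
          (cong (λ xs → map suc xs ++ maximalSizes k) (sizesOf-false (sublists (pathEdges (suc k)))))

  matchingSizes-suc : ∀ k → matchingSizes (suc k) ≡ map suc (avoidingMatchingSizes k) ++ matchingSizes k
  matchingSizes-suc k = pathSizes-suc k isMatching-first isMatching-shift

  avoidingMatchingSizes-suc : ∀ k → avoidingMatchingSizes (suc k) ≡ matchingSizes k
  avoidingMatchingSizes-suc k =
    trans (pathSizes-suc k (λ _ → refl) (λ M → cong₂ (λ c m → not c ∧ m) (covers₀-shift M) (isMatching-shift M)))
          (cong (λ xs → map suc xs ++ matchingSizes k) (sizesOf-false (sublists (pathEdges (suc k)))))

  length-maximalSizes-rec : ∀ k → length (maximalSizes (3 + k)) ≡ length (maximalSizes (1 + k)) + length (maximalSizes k)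
  length-maximalSizes-rec k = begin
    length (maximalSizes (3 + k))
      ≡⟨ cong length (maximalSizes-suc (2 + k)) ⟩
    length (map suc (avoidingSizes (2 + k)) ++ coveringSizes (2 + k))
      ≡⟨ length-++ (map suc (avoidingSizes (2 + k))) ⟩
    length (map suc (avoidingSizes (2 + k))) + length (coveringSizes (2 + k))
      ≡⟨ cong₂ _+_ (trans (length-map suc (avoidingSizes (2 + k))) (cong length (avoidingSizes-suc (1 + k))))
                   (cong length (coveringSizes-suc (1 + k))) ⟩
    length (maximalSizes (1 + k)) + length (map suc (avoidingSizes (1 + k)))
      ≡⟨ cong (length (maximalSizes (1 + k)) +_) (trans (length-map suc (avoidingSizes (1 + k))) (cong length (avoidingSizes-suc k))) ⟩
    length (maximalSizes (1 + k)) + length (maximalSizes k) ∎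
    where open ≡-Reasoning

  sum-maximalSizes-rec : ∀ k → sum (maximalSizes (3 + k))
                               ≡ (sum (maximalSizes (1 + k)) + length (maximalSizes (1 + k)))
                                 + (sum (maximalSizes k) + length (maximalSizes k))
  sum-maximalSizes-rec k = begin
    sum (maximalSizes (3 + k))
      ≡⟨ cong sum (maximalSizes-suc (2 + k)) ⟩
    sum (map suc (avoidingSizes (2 + k)) ++ coveringSizes (2 + k))
      ≡⟨ sum-++ (map suc (avoidingSizes (2 + k))) (coveringSizes (2 + k)) ⟩
    sum (map suc (avoidingSizes (2 + k))) + sum (coveringSizes (2 + k))
      ≡⟨ cong₂ _+_ (trans (sum-map-suc (avoidingSizes (2 + k))) (cong (λ xs → sum xs + length xs) (avoidingSizes-suc (1 + k))))
                   (cong sum (coveringSizes-suc (1 + k))) ⟩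
    (sum (maximalSizes (1 + k)) + length (maximalSizes (1 + k))) + sum (map suc (avoidingSizes (1 + k)))
      ≡⟨ cong (sum (maximalSizes (1 + k)) + length (maximalSizes (1 + k)) +_)
              (trans (sum-map-suc (avoidingSizes (1 + k))) (cong (λ xs → sum xs + length xs) (avoidingSizes-suc k))) ⟩
    (sum (maximalSizes (1 + k)) + length (maximalSizes (1 + k))) + (sum (maximalSizes k) + length (maximalSizes k)) ∎
    where open ≡-Reasoning

  length-maximalSizes : ∀ k → length (maximalSizes k) ≡ A k
  length-maximalSizes 0 = refl
  length-maximalSizes 1 = refl
  length-maximalSizes 2 = refl
  length-maximalSizes (suc (suc (suc k))) =
    trans (length-maximalSizes-rec k) (cong₂ _+_ (length-maximalSizes (suc k)) (length-maximalSizes k))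

  𝒯₀-path : ∀ k → 𝒯₀ (P (suc k)) ≡ A k
  𝒯₀-path k = trans (sym (length-map length (maximalMatchings (P (suc k))))) (length-maximalSizes k)

  𝒯₁-path : ∀ k → 𝒯₁ (P (suc k)) ≡ B k
  𝒯₁-path 0 = refl
  𝒯₁-path 1 = refl
  𝒯₁-path 2 = refl
  𝒯₁-path (suc (suc (suc k))) =
    trans (sum-maximalSizes-rec k)
          (cong₂ _+_ (cong₂ _+_ (𝒯₁-path (suc k)) (length-maximalSizes (suc k)))
                     (cong₂ _+_ (𝒯₁-path k) (length-maximalSizes k)))

  matchingSizes-nonempty : ∀ k → matchingSizes k ≢ []
  matchingSizes-nonempty 0       ()
  matchingSizes-nonempty (suc k) eq =
    matchingSizes-nonempty k (++-conicalʳ (map suc (avoidingMatchingSizes k)) (matchingSizes k)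
                                          (trans (sym (matchingSizes-suc k)) eq))

  ν-path : ∀ k → ν (P (suc k)) ≡ ⌈ k /2⌉
  ν-path 0 = refl
  ν-path 1 = refl
  ν-path (suc (suc k)) = begin
    maximum (matchingSizes (2 + k))
      ≡⟨ cong maximum (matchingSizes-suc (1 + k)) ⟩
    maximum (map suc (avoidingMatchingSizes (1 + k)) ++ matchingSizes (1 + k))
      ≡⟨ maximum-++ (map suc (avoidingMatchingSizes (1 + k))) (matchingSizes (1 + k)) ⟩
    maximum (map suc (avoidingMatchingSizes (1 + k))) ⊔ maximum (matchingSizes (1 + k))
      ≡⟨ cong (_⊔ maximum (matchingSizes (1 + k)))
              (trans (cong (maximum ∘ map suc) (avoidingMatchingSizes-suc k))
                     (maximum-map-suc (matchingSizes k) (matchingSizes-nonempty k))) ⟩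
    suc (maximum (matchingSizes k)) ⊔ maximum (matchingSizes (1 + k))
      ≡⟨ cong₂ (λ a b → suc a ⊔ b) (ν-path k) (ν-path (suc k)) ⟩
    suc ⌈ k /2⌉ ⊔ ⌈ suc k /2⌉
      ≡⟨ m≥n⇒m⊔n≡m (s≤s (⌊n/2⌋≤⌈n/2⌉ k)) ⟩
    suc ⌈ k /2⌉ ∎
    where open ≡-Reasoning

module PadovanRatio where

  open Padovan
  open import Data.Nat
  open import Data.Nat.Properties
  open import Data.Integer as ℤ using (ℤ; +_)
  import Data.Integer.Properties as ℤ
  open import Data.Integer.Tactic.RingSolver as ℤ-Solver using ()
  open import Data.Nat.Tactic.RingSolver as ℕ-Solver using ()
  open import Data.Product using (∃; _×_; _,_)
  open import Data.Sum using (inj₁; inj₂)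
  open import Relation.Binary.PropositionalEquality
  open import Relation.Nullary using (¬_)
  open import Relation.Nullary.Decidable using (from-yes)

  A-positive : ∀ k → 0 < A k
  A-positive 0 = z<s
  A-positive 1 = z<s
  A-positive 2 = z<s
  A-positive (suc (suc (suc k))) = ≤-trans (A-positive (suc k)) (m≤m+n _ _)

  A-mono : ∀ k → A k ≤ A (suc k)
  A-mono 0 = ≤-refl
  A-mono 1 = from-yes (1 ≤? 2)
  A-mono 2 = ≤-refl
  A-mono (suc (suc (suc k))) = +-mono-≤ (A-mono (suc k)) (A-mono k)

  A-suc≤2*A : ∀ k → A (suc k) ≤ 2 * A k
  A-suc≤2*A 0 = from-yes (1 ≤? 2)
  A-suc≤2*A 1 = ≤-refl
  A-suc≤2*A 2 = from-yes (2 ≤? 4)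
  A-suc≤2*A (suc (suc (suc k))) =
    ≤-trans (+-mono-≤ (A-suc≤2*A (suc k)) (A-suc≤2*A k)) (≤-reflexive (sym (*-distribˡ-+ 2 (A (suc k)) (A k))))

  det : ℕ → ℤ
  det k = + A k ℤ.* + A (2 + k) ℤ.- + A (1 + k) ℤ.* + A (1 + k)

  det-rec : ∀ k → det (3 + k) ≡ det k ℤ.- det (2 + k)
  det-rec k = identity (+ A k) (+ A (1 + k)) (+ A (2 + k))
    where
    identity : ∀ a₀ a₁ a₂ → (a₁ ℤ.+ a₀) ℤ.* ((a₁ ℤ.+ a₀) ℤ.+ a₂) ℤ.- (a₂ ℤ.+ a₁) ℤ.* (a₂ ℤ.+ a₁)
                          ≡ (a₀ ℤ.* a₂ ℤ.- a₁ ℤ.* a₁) ℤ.- (a₂ ℤ.* (a₂ ℤ.+ a₁) ℤ.- (a₁ ℤ.+ a₀) ℤ.* (a₁ ℤ.+ a₀))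
    identity = ℤ-Solver.solve-∀

  -- Dominates ∣ det ∣ by det-rec and the triangle inequality.
  detBound : ℕ → ℕ
  detBound 0 = 2
  detBound 1 = 2
  detBound 2 = 2
  detBound (suc (suc (suc k))) = detBound (suc (suc k)) + detBound k

  detBound-positive : ∀ k → 0 < detBound k
  detBound-positive 0 = z<s
  detBound-positive 1 = z<s
  detBound-positive 2 = z<s
  detBound-positive (suc (suc (suc k))) = ≤-trans (detBound-positive (suc (suc k))) (m≤m+n _ _)

  detBound-mono : ∀ k → detBound k ≤ detBound (suc k)
  detBound-mono 0 = ≤-refl
  detBound-mono 1 = ≤-refl
  detBound-mono (suc (suc k)) = m≤m+n (detBound (suc (suc k))) (detBound k)

  ∣det∣≤detBound : ∀ k → ℤ.∣ det k ∣ ≤ detBound k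
  ∣det∣≤detBound 0 = from-yes (1 ≤? 2)
  ∣det∣≤detBound 1 = ≤-refl
  ∣det∣≤detBound 2 = ≤-refl
  ∣det∣≤detBound (suc (suc (suc k))) = begin
    ℤ.∣ det (3 + k) ∣                   ≡⟨ cong ℤ.∣_∣ (det-rec k) ⟩
    ℤ.∣ det k ℤ.- det (2 + k) ∣          ≤⟨ ℤ.∣i-j∣≤∣i∣+∣j∣ (det k) (det (2 + k)) ⟩
    ℤ.∣ det k ∣ + ℤ.∣ det (2 + k) ∣      ≤⟨ +-mono-≤ (∣det∣≤detBound k) (∣det∣≤detBound (suc (suc k))) ⟩
    detBound k + detBound (2 + k)        ≡⟨ +-comm (detBound k) (detBound (2 + k)) ⟩
    detBound (3 + k)                     ∎
    where open ≤-Reasoning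

  ∣+m-+n∣≡∣m-n∣ : ∀ m n → ℤ.∣ + m ℤ.- + n ∣ ≡ ∣ m - n ∣
  ∣+m-+n∣≡∣m-n∣ m n with ≤-total m n
  ... | inj₁ m≤n = trans (cong ℤ.∣_∣ (ℤ.[+m]-[+n]≡m⊖n m n)) (trans (ℤ.∣⊖∣-≤ m≤n) (sym (m≤n⇒∣m-n∣≡n∸m m≤n)))
  ... | inj₂ n≤m = trans (cong ℤ.∣_∣ (ℤ.[+m]-[+n]≡m⊖n m n))
                         (trans (ℤ.∣m⊖n∣≡∣n⊖m∣ m n) (trans (ℤ.∣⊖∣-≤ n≤m) (sym (m≤n⇒∣n-m∣≡n∸m n≤m))))

  -- With x = A (1 + m), y = A (2 + m) and A (4 + m) = y + x, this is x³ ∣ρ³ - ρ - 1∣ for ρ = y / x.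
  cubicDefect : ℕ → ℕ
  cubicDefect m = ∣ A (1 + m) * A (1 + m) * A (4 + m) - A (2 + m) * A (2 + m) * A (2 + m) ∣

  cubicDefect-det : ∀ m → + (A (1 + m) * A (1 + m) * A (4 + m)) ℤ.- + (A (2 + m) * A (2 + m) * A (2 + m))
                          ≡ + A (2 + m) ℤ.* det (1 + m) ℤ.- + A (1 + m) ℤ.* det m
  cubicDefect-det m = begin
    + (x * x * A (4 + m)) ℤ.- + (y * y * y)
      ≡⟨ cong₂ ℤ._-_ (trans (ℤ.pos-* (x * x) (A (4 + m))) (cong (ℤ._* + A (4 + m)) (ℤ.pos-* x x)))
                     (trans (ℤ.pos-* (y * y) y) (cong (ℤ._* + y) (ℤ.pos-* y y))) ⟩
    + x ℤ.* + x ℤ.* + A (4 + m) ℤ.- + y ℤ.* + y ℤ.* + y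
      ≡⟨ identity (+ A m) (+ x) (+ y) ⟩
    + y ℤ.* det (1 + m) ℤ.- + x ℤ.* det m ∎
    where
    open ≡-Reasoning
    x = A (1 + m)
    y = A (2 + m)
    identity : ∀ a₀ x y → x ℤ.* x ℤ.* (y ℤ.+ x) ℤ.- y ℤ.* y ℤ.* y
                          ≡ y ℤ.* (x ℤ.* (x ℤ.+ a₀) ℤ.- y ℤ.* y) ℤ.- x ℤ.* (a₀ ℤ.* y ℤ.- x ℤ.* x)
    identity = ℤ-Solver.solve-∀

  cubicDefect≤ : ∀ m → cubicDefect m ≤ 3 * (A (1 + m) * detBound (1 + m))
  cubicDefect≤ m = begin
    cubicDefect m
      ≡⟨ ∣+m-+n∣≡∣m-n∣ (x * x * A (4 + m)) (y * y * y) ⟨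
    ℤ.∣ + (x * x * A (4 + m)) ℤ.- + (y * y * y) ∣
      ≡⟨ cong ℤ.∣_∣ (cubicDefect-det m) ⟩
    ℤ.∣ + y ℤ.* det (1 + m) ℤ.- + x ℤ.* det m ∣
      ≤⟨ ℤ.∣i-j∣≤∣i∣+∣j∣ (+ y ℤ.* det (1 + m)) (+ x ℤ.* det m) ⟩
    ℤ.∣ + y ℤ.* det (1 + m) ∣ + ℤ.∣ + x ℤ.* det m ∣
      ≡⟨ cong₂ _+_ (ℤ.abs-* (+ y) (det (1 + m))) (ℤ.abs-* (+ x) (det m)) ⟩
    y * ℤ.∣ det (1 + m) ∣ + x * ℤ.∣ det m ∣
      ≤⟨ +-mono-≤ (*-mono-≤ (A-suc≤2*A (1 + m)) (∣det∣≤detBound (1 + m)))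
                  (*-monoʳ-≤ x (≤-trans (∣det∣≤detBound m) (detBound-mono m))) ⟩
    2 * x * detBound (1 + m) + x * detBound (1 + m)
      ≡⟨ identity x (detBound (1 + m)) ⟩
    3 * (x * detBound (1 + m)) ∎
    where
    open ≤-Reasoning
    x = A (1 + m)
    y = A (2 + m)
    identity : ∀ x g → 2 * x * g + x * g ≡ 3 * (x * g)
    identity = ℕ-Solver.solve-∀

  ^-distribʳ-* : ∀ m n k → (m * n) ^ k ≡ m ^ k * n ^ k
  ^-distribʳ-* m n 0       = refl
  ^-distribʳ-* m n (suc k) = trans (cong (m * n *_) (^-distribʳ-* m n k)) (identity m n (m ^ k) (n ^ k))
    where
    identity : ∀ m n a b → m * n * (a * b) ≡ m * a * (n * b)
    identity = ℕ-Solver.solve-∀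

  5^k≤2*3^k*A² : ∀ k → 5 ^ k ≤ 2 * 3 ^ k * (A k * A k)
  5^k≤2*3^k*A² 0 = from-yes (1 ≤? 2)
  5^k≤2*3^k*A² 1 = from-yes (5 ≤? 6)
  5^k≤2*3^k*A² 2 = from-yes (25 ≤? 72)
  5^k≤2*3^k*A² (suc (suc (suc k))) = begin
    5 ^ (3 + k)
      ≤⟨ m≤m+n (5 ^ (3 + k)) (5 ^ k) ⟩
    5 ^ (3 + k) + 5 ^ k
      ≡⟨ split (5 ^ k) ⟩
    9 * 5 ^ (1 + k) + 81 * 5 ^ k
      ≤⟨ +-mono-≤ (*-monoʳ-≤ 9 (5^k≤2*3^k*A² (suc k))) (*-monoʳ-≤ 81 (5^k≤2*3^k*A² k)) ⟩
    9 * (2 * 3 ^ (1 + k) * (a₁ * a₁)) + 81 * (2 * 3 ^ k * (a₀ * a₀))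
      ≡⟨ regroup (3 ^ k) a₁ a₀ ⟩
    2 * 3 ^ (3 + k) * (a₁ * a₁ + 3 * (a₀ * a₀))
      ≤⟨ *-monoʳ-≤ (2 * 3 ^ (3 + k)) (square-bound (A-mono k)) ⟩
    2 * 3 ^ (3 + k) * (A (3 + k) * A (3 + k)) ∎
    where
    open ≤-Reasoning
    a₁ = A (1 + k)
    a₀ = A k
    split : ∀ t → 5 * (5 * (5 * t)) + t ≡ 9 * (5 * t) + 81 * t
    split = ℕ-Solver.solve-∀
    regroup : ∀ t a₁ a₀ → 9 * (2 * (3 * t) * (a₁ * a₁)) + 81 * (2 * t * (a₀ * a₀))
                          ≡ 2 * (3 * (3 * (3 * t))) * (a₁ * a₁ + 3 * (a₀ * a₀))
    regroup = ℕ-Solver.solve-∀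
    square-bound : ∀ {a₀ a₁} → a₀ ≤ a₁ → a₁ * a₁ + 3 * (a₀ * a₀) ≤ (a₁ + a₀) * (a₁ + a₀)
    square-bound {a₀} {a₁} a₀≤a₁ = begin
      a₁ * a₁ + 3 * (a₀ * a₀)             ≡⟨ expand₁ a₀ a₁ ⟩
      a₁ * a₁ + a₀ * a₀ + 2 * (a₀ * a₀)   ≤⟨ +-monoʳ-≤ (a₁ * a₁ + a₀ * a₀) (*-monoʳ-≤ 2 (*-monoˡ-≤ a₀ a₀≤a₁)) ⟩
      a₁ * a₁ + a₀ * a₀ + 2 * (a₁ * a₀)   ≡⟨ expand₂ a₀ a₁ ⟩
      (a₁ + a₀) * (a₁ + a₀)               ∎
      where
      expand₁ : ∀ a₀ a₁ → a₁ * a₁ + 3 * (a₀ * a₀) ≡ a₁ * a₁ + a₀ * a₀ + 2 * (a₀ * a₀)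
      expand₁ = ℕ-Solver.solve-∀
      expand₂ : ∀ a₀ a₁ → a₁ * a₁ + a₀ * a₀ + 2 * (a₁ * a₀) ≡ (a₁ + a₀) * (a₁ + a₀)
      expand₂ = ℕ-Solver.solve-∀

  2^k*detBound≤2*3^k : ∀ k → 2 ^ k * detBound k ≤ 2 * 3 ^ k
  2^k*detBound≤2*3^k 0 = ≤-refl
  2^k*detBound≤2*3^k 1 = from-yes (4 ≤? 6)
  2^k*detBound≤2*3^k 2 = from-yes (8 ≤? 18)
  2^k*detBound≤2*3^k (suc (suc (suc k))) = begin
    2 ^ (3 + k) * detBound (3 + k)
      ≡⟨ split (2 ^ k) (detBound (2 + k)) (detBound k) ⟩
    2 * (2 ^ (2 + k) * detBound (2 + k)) + 8 * (2 ^ k * detBound k)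
      ≤⟨ +-mono-≤ (*-monoʳ-≤ 2 (2^k*detBound≤2*3^k (suc (suc k)))) (*-monoʳ-≤ 8 (2^k*detBound≤2*3^k k)) ⟩
    2 * (2 * 3 ^ (2 + k)) + 8 * (2 * 3 ^ k)
      ≤⟨ m≤m+n _ (2 * 3 ^ k) ⟩
    2 * (2 * 3 ^ (2 + k)) + 8 * (2 * 3 ^ k) + 2 * 3 ^ k
      ≡⟨ regroup (3 ^ k) ⟩
    2 * 3 ^ (3 + k) ∎
    where
    open ≤-Reasoning
    split : ∀ t g₂ g₀ → 2 * (2 * (2 * t)) * (g₂ + g₀) ≡ 2 * (2 * (2 * t) * g₂) + 8 * (t * g₀)
    split = ℕ-Solver.solve-∀
    regroup : ∀ t → 2 * (2 * (3 * (3 * t))) + 8 * (2 * t) + 2 * t ≡ 2 * (3 * (3 * (3 * t)))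
    regroup = ℕ-Solver.solve-∀

  9^k*[9+k]≤9*10^k : ∀ k → 9 ^ k * (9 + k) ≤ 9 * 10 ^ k
  9^k*[9+k]≤9*10^k 0       = ≤-refl
  9^k*[9+k]≤9*10^k (suc k) = begin
    9 * 9 ^ k * (10 + k)              ≤⟨ m≤m+n (9 * 9 ^ k * (10 + k)) (9 ^ k * k) ⟩
    9 * 9 ^ k * (10 + k) + 9 ^ k * k  ≡⟨ regroup (9 ^ k) k ⟩
    10 * (9 ^ k * (9 + k))            ≤⟨ *-monoʳ-≤ 10 (9^k*[9+k]≤9*10^k k) ⟩
    10 * (9 * 10 ^ k)                 ≡⟨ swap (10 ^ k) ⟩
    9 * 10 ^ suc k                    ∎
    where
    open ≤-Reasoning
    regroup : ∀ t k → 9 * t * (10 + k) + t * k ≡ 10 * (t * (9 + k))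
    regroup = ℕ-Solver.solve-∀
    swap : ∀ t → 10 * (9 * t) ≡ 9 * (10 * t)
    swap = ℕ-Solver.solve-∀

  -- detBound grows like 1.47ᵏ and A² like 1.75ᵏ; 5 / 3 and 3 / 2 are rates in between, and the
  -- gap between them beats the linear factor 9 + k.
  [9+k]*detBound≤36*A² : ∀ k → (9 + k) * detBound k ≤ 36 * (A k * A k)
  [9+k]*detBound≤36*A² k = *-cancelˡ-≤ (9 ^ k) {{>-nonZero (m^n>0 9 k)}} (begin
    9 ^ k * ((9 + k) * detBound k)            ≡⟨ *-assoc (9 ^ k) (9 + k) (detBound k) ⟨
    9 ^ k * (9 + k) * detBound k              ≤⟨ *-monoˡ-≤ (detBound k) (9^k*[9+k]≤9*10^k k) ⟩
    9 * 10 ^ k * detBound k                   ≡⟨ cong (λ t → 9 * t * detBound k) (^-distribʳ-* 5 2 k) ⟩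
    9 * (5 ^ k * 2 ^ k) * detBound k          ≡⟨ reassoc (5 ^ k) (2 ^ k) (detBound k) ⟩
    9 * (5 ^ k * (2 ^ k * detBound k))        ≤⟨ *-monoʳ-≤ 9 (*-mono-≤ (5^k≤2*3^k*A² k) (2^k*detBound≤2*3^k k)) ⟩
    9 * (2 * 3 ^ k * (A k * A k) * (2 * 3 ^ k)) ≡⟨ regroup (3 ^ k) (A k * A k) ⟩
    3 ^ k * 3 ^ k * (36 * (A k * A k))        ≡⟨ cong (_* (36 * (A k * A k))) (^-distribʳ-* 3 3 k) ⟨
    9 ^ k * (36 * (A k * A k))                ∎)
    where
    open ≤-Reasoning
    reassoc : ∀ a b g → 9 * (a * b) * g ≡ 9 * (a * (b * g))
    reassoc = ℕ-Solver.solve-∀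
    regroup : ∀ t s → 9 * (2 * t * s * (2 * t)) ≡ t * t * (36 * s)
    regroup = ℕ-Solver.solve-∀

  cubicDefect-small : ∀ c m → 36 * (3 * c + 1) ≤ 10 + m → c * cubicDefect m < A (1 + m) * A (1 + m) * A (1 + m)
  cubicDefect-small c m large = begin-strict
    c * cubicDefect m     ≤⟨ *-monoʳ-≤ c (cubicDefect≤ m) ⟩
    c * (3 * (x * g))     ≡⟨ regroup c x g ⟩
    x * (3 * c * g)       <⟨ *-monoʳ-< x {{>-nonZero (A-positive (1 + m))}} 3cg<x² ⟩
    x * (x * x)           ≡⟨ *-assoc x x x ⟨
    x * x * x             ∎
    where
    open ≤-Reasoning
    x = A (1 + m)
    g = detBound (1 + m)
    regroup : ∀ c x g → c * (3 * (x * g)) ≡ x * (3 * c * g)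
    regroup = ℕ-Solver.solve-∀
    [3c+1]g≤x² : (3 * c + 1) * g ≤ x * x
    [3c+1]g≤x² = *-cancelˡ-≤ 36 (begin
      36 * ((3 * c + 1) * g)   ≡⟨ *-assoc 36 (3 * c + 1) g ⟨
      36 * (3 * c + 1) * g     ≤⟨ *-monoˡ-≤ g large ⟩
      (10 + m) * g             ≤⟨ [9+k]*detBound≤36*A² (1 + m) ⟩
      36 * (x * x)             ∎)
    3cg<x² : 3 * c * g < x * x
    3cg<x² = begin-strict
      3 * c * g                <⟨ m<m+n (3 * c * g) (detBound-positive (1 + m)) ⟩
      3 * c * g + g            ≡⟨ cong (_+_ (3 * c * g)) (*-identityˡ g) ⟨
      3 * c * g + 1 * g        ≡⟨ *-distribʳ-+ g (3 * c) 1 ⟨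
      (3 * c + 1) * g          ≤⟨ [3c+1]g≤x² ⟩
      x * x                    ∎

  -- t ↦ t³ - t x² is nonpositive for t ≤ x and increasing for t ≥ x, stated without subtraction.
  cubic-mono : ∀ {x y z} → x ≤ z → y ≤ z → y * y * y + z * (x * x) ≤ z * z * z + y * (x * x)
  cubic-mono {x} {y} x≤z y≤z with m≤n⇒∃[o]m+o≡n y≤z
  ... | e , refl = begin
    y * y * y + (y + e) * (x * x)
      ≡⟨ split x y e ⟩
    y * y * y + y * (x * x) + e * (x * x)
      ≤⟨ +-monoʳ-≤ (y * y * y + y * (x * x)) (*-monoʳ-≤ e (*-mono-≤ x≤z x≤z)) ⟩
    y * y * y + y * (x * x) + e * ((y + e) * (y + e))
      ≤⟨ m≤m+n _ (e * (2 * (y * y) + y * e)) ⟩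
    y * y * y + y * (x * x) + e * ((y + e) * (y + e)) + e * (2 * (y * y) + y * e)
      ≡⟨ regroup x y e ⟩
    (y + e) * (y + e) * (y + e) + y * (x * x) ∎
    where
    open ≤-Reasoning
    split : ∀ x y e → y * y * y + (y + e) * (x * x) ≡ y * y * y + y * (x * x) + e * (x * x)
    split = ℕ-Solver.solve-∀
    regroup : ∀ x y e → y * y * y + y * (x * x) + e * ((y + e) * (y + e)) + e * (2 * (y * y) + y * e)
                        ≡ (y + e) * (y + e) * (y + e) + y * (x * x)
    regroup = ℕ-Solver.solve-∀

  -- p / d lies below, resp. above, the plastic number, the real root of x³ = x + 1.
  BelowPlastic AbovePlastic : ℕ → ℕ → Set
  BelowPlastic p d = p * p * p < p * (d * d) + d * d * d
  AbovePlastic p d = p * (d * d) + d * d * d < p * p * p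

  Eventually : (ℕ → Set) → Set
  Eventually Q = ∃ λ N → ∀ k → N ≤ k → Q k

  Eventually-map : ∀ {Q R : ℕ → Set} → (∀ k → Q k → R k) → Eventually Q → Eventually R
  Eventually-map f (N , q) = N , λ k N≤k → f k (q k N≤k)

  Eventually-× : ∀ {Q R : ℕ → Set} → Eventually Q → Eventually R → Eventually (λ k → Q k × R k)
  Eventually-× (N₁ , q) (N₂ , r) = N₁ + N₂ , λ k N≤k → q k (m+n≤o⇒m≤o N₁ N≤k) , r k (m+n≤o⇒n≤o N₁ N≤k)

  -- A ratio y / x ≥ 1 below p / d < r makes y³ - x² y - x³ ≤ -x³ / d³ (and symmetrically above r).
  below-plastic-defect : ∀ {p d x y} → BelowPlastic p d → x ≤ y → d * y < p * x →
                         x * x * x + d * d * d * (y * y * y) ≤ d * d * d * (x * x * (y + x))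
  below-plastic-defect {p} {d} {x} {y} below x≤y dy<px = +-cancelʳ-≤ (p * (d * d) * (x * x * x)) _ _ (begin
    x * x * x + d * d * d * (y * y * y) + p * (d * d) * (x * x * x)
      ≡⟨ identity₁ x y d p ⟩
    x * x * x + ((d * y) * (d * y) * (d * y) + (p * x) * ((d * x) * (d * x)))
      ≤⟨ +-monoʳ-≤ (x * x * x) (cubic-mono (≤-trans (*-monoʳ-≤ d x≤y) (<⇒≤ dy<px)) (<⇒≤ dy<px)) ⟩
    x * x * x + ((p * x) * (p * x) * (p * x) + (d * y) * ((d * x) * (d * x)))
      ≡⟨ identity₂ x y d p ⟩
    (1 + p * p * p) * (x * x * x) + d * d * d * (x * x * y)
      ≤⟨ +-monoˡ-≤ (d * d * d * (x * x * y)) (*-monoˡ-≤ (x * x * x) below) ⟩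
    (p * (d * d) + d * d * d) * (x * x * x) + d * d * d * (x * x * y)
      ≡⟨ identity₃ x y d p ⟩
    d * d * d * (x * x * (y + x)) + p * (d * d) * (x * x * x) ∎)
    where
    open ≤-Reasoning
    identity₁ : ∀ x y d p → x * x * x + d * d * d * (y * y * y) + p * (d * d) * (x * x * x)
                            ≡ x * x * x + ((d * y) * (d * y) * (d * y) + (p * x) * ((d * x) * (d * x)))
    identity₁ = ℕ-Solver.solve-∀
    identity₂ : ∀ x y d p → x * x * x + ((p * x) * (p * x) * (p * x) + (d * y) * ((d * x) * (d * x)))
                            ≡ (1 + p * p * p) * (x * x * x) + d * d * d * (x * x * y)
    identity₂ = ℕ-Solver.solve-∀
    identity₃ : ∀ x y d p → (p * (d * d) + d * d * d) * (x * x * x) + d * d * d * (x * x * y)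
                            ≡ d * d * d * (x * x * (y + x)) + p * (d * d) * (x * x * x)
    identity₃ = ℕ-Solver.solve-∀

  above-plastic-defect : ∀ {p d x y} → AbovePlastic p d → x ≤ y → p * x < d * y →
                         x * x * x + d * d * d * (x * x * (y + x)) ≤ d * d * d * (y * y * y)
  above-plastic-defect {p} {d} {x} {y} above x≤y px<dy = +-cancelʳ-≤ (p * (d * d) * (x * x * x)) _ _ (begin
    x * x * x + d * d * d * (x * x * (y + x)) + p * (d * d) * (x * x * x)
      ≡⟨ identity₁ x y d p ⟩
    (1 + (p * (d * d) + d * d * d)) * (x * x * x) + d * d * d * (x * x * y)
      ≤⟨ +-monoˡ-≤ (d * d * d * (x * x * y)) (*-monoˡ-≤ (x * x * x) above) ⟩
    p * p * p * (x * x * x) + d * d * d * (x * x * y)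
      ≡⟨ identity₂ x y d p ⟩
    (p * x) * (p * x) * (p * x) + (d * y) * ((d * x) * (d * x))
      ≤⟨ cubic-mono (*-monoʳ-≤ d x≤y) (<⇒≤ px<dy) ⟩
    (d * y) * (d * y) * (d * y) + (p * x) * ((d * x) * (d * x))
      ≡⟨ identity₃ x y d p ⟩
    d * d * d * (y * y * y) + p * (d * d) * (x * x * x) ∎)
    where
    open ≤-Reasoning
    identity₁ : ∀ x y d p → x * x * x + d * d * d * (x * x * (y + x)) + p * (d * d) * (x * x * x)
                            ≡ (1 + (p * (d * d) + d * d * d)) * (x * x * x) + d * d * d * (x * x * y)
    identity₁ = ℕ-Solver.solve-∀
    identity₂ : ∀ x y d p → p * p * p * (x * x * x) + d * d * d * (x * x * y)
                            ≡ (p * x) * (p * x) * (p * x) + (d * y) * ((d * x) * (d * x))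
    identity₂ = ℕ-Solver.solve-∀
    identity₃ : ∀ x y d p → (d * y) * (d * y) * (d * y) + (p * x) * ((d * x) * (d * x))
                            ≡ d * d * d * (y * y * y) + p * (d * d) * (x * x * x)
    identity₃ = ℕ-Solver.solve-∀

  A-ratio-above : ∀ {p d} → BelowPlastic p d → Eventually (λ k → p * A k ≤ d * A (suc k))
  A-ratio-above {p} {d} below = suc (36 * (3 * c + 1)) , ratio
    where
    c = d * d * d
    ratio : ∀ k → suc (36 * (3 * c + 1)) ≤ k → p * A k ≤ d * A (suc k)
    ratio (suc m) (s≤s N≤m) = ≮⇒≥ λ dy<px →
      <⇒≱ (begin-strict
        c * (x * x * A (4 + m))              ≤⟨ *-monoʳ-≤ c (m≤n+∣m-n∣ (x * x * A (4 + m)) (y * y * y)) ⟩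
        c * (y * y * y + cubicDefect m)      ≡⟨ *-distribˡ-+ c (y * y * y) (cubicDefect m) ⟩
        c * (y * y * y) + c * cubicDefect m  <⟨ +-monoʳ-< (c * (y * y * y)) (cubicDefect-small c m (≤-trans N≤m (m≤n+m m 10))) ⟩
        c * (y * y * y) + x * x * x          ≡⟨ +-comm (c * (y * y * y)) (x * x * x) ⟩
        x * x * x + c * (y * y * y)          ∎)
          (below-plastic-defect {p} {d} below (A-mono (1 + m)) dy<px)
      where
      open ≤-Reasoning
      x = A (1 + m)
      y = A (2 + m)

  A-ratio-below : ∀ {p d} → AbovePlastic p d → Eventually (λ k → d * A (suc k) ≤ p * A k)
  A-ratio-below {p} {d} above = suc (36 * (3 * c + 1)) , ratio
    where
    c = d * d * d
    ratio : ∀ k → suc (36 * (3 * c + 1)) ≤ k → d * A (suc k) ≤ p * A k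
    ratio (suc m) (s≤s N≤m) = ≮⇒≥ λ px<dy →
      <⇒≱ (begin-strict
        c * (y * y * y)                              ≤⟨ *-monoʳ-≤ c (m≤n+∣n-m∣ (y * y * y) (x * x * A (4 + m))) ⟩
        c * (x * x * A (4 + m) + cubicDefect m)      ≡⟨ *-distribˡ-+ c (x * x * A (4 + m)) (cubicDefect m) ⟩
        c * (x * x * A (4 + m)) + c * cubicDefect m  <⟨ +-monoʳ-< (c * (x * x * A (4 + m)))
                                                                  (cubicDefect-small c m (≤-trans N≤m (m≤n+m m 10))) ⟩
        c * (x * x * A (4 + m)) + x * x * x          ≡⟨ +-comm (c * (x * x * A (4 + m))) (x * x * x) ⟩
        x * x * x + c * (x * x * A (4 + m))          ∎)
          (above-plastic-defect {p} {d} above (A-mono (1 + m)) px<dy)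
      where
      open ≤-Reasoning
      x = A (1 + m)
      y = A (2 + m)

module SizeAsymptotics where

  open Padovan
  open PadovanRatio
  open import Data.Nat
  open import Data.Nat.Properties
  open import Data.Nat.Tactic.RingSolver as ℕ-Solver using ()
  open import Data.Product using (∃; ∃₂; _×_; _,_)
  open import Relation.Binary.PropositionalEquality
  open import Relation.Nullary using (contradiction)

  -- K * A k absorbs the initial values, A being a solution of the homogeneous recurrence.
  dominated-eventually : (X Y : ℕ → ℕ) →
    Eventually (λ k → Y (3 + k) + (X (1 + k) + X k) ≤ X (3 + k) + (Y (1 + k) + Y k)) →
    ∃ λ K → Eventually (λ k → Y k ≤ X k + K * A k)
  dominated-eventually X Y (N , slower) = K , N , λ k N≤k → subst Q (m∸n+n≡m N≤k) (from (k ∸ N))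
    where
    K = Y N + Y (1 + N) + Y (2 + N)
    Q : ℕ → Set
    Q i = Y i ≤ X i + K * A i
    initial : ∀ i → Y i ≤ K → Q i
    initial i Yi≤K = ≤-trans Yi≤K (≤-trans (m≤m*n K (A i) {{>-nonZero (A-positive i)}}) (m≤n+m (K * A i) (X i)))
    from : ∀ j → Q (j + N)
    from 0 = initial N (≤-trans (m≤m+n (Y N) (Y (1 + N))) (m≤m+n _ (Y (2 + N))))
    from 1 = initial (1 + N) (≤-trans (m≤n+m (Y (1 + N)) (Y N)) (m≤m+n _ (Y (2 + N))))
    from 2 = initial (2 + N) (m≤n+m (Y (2 + N)) _)
    from (suc (suc (suc j))) = +-cancelʳ-≤ (X (1 + i) + X i) (Y (3 + i)) _ (begin
      Y (3 + i) + (X (1 + i) + X i)                              ≤⟨ slower i (m≤n+m N j) ⟩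
      X (3 + i) + (Y (1 + i) + Y i)                              ≤⟨ +-monoʳ-≤ (X (3 + i)) (+-mono-≤ (from (suc j)) (from j)) ⟩
      X (3 + i) + ((X (1 + i) + K * A (1 + i)) + (X i + K * A i)) ≡⟨ regroup (X (3 + i)) (X (1 + i)) (X i) K (A (1 + i)) (A i) ⟩
      X (3 + i) + K * A (3 + i) + (X (1 + i) + X i)              ∎)
      where
      open ≤-Reasoning
      i = j + N
      regroup : ∀ x₃ x₁ x₀ K a₁ a₀ → x₃ + ((x₁ + K * a₁) + (x₀ + K * a₀)) ≡ x₃ + K * (a₁ + a₀) + (x₁ + x₀)
      regroup = ℕ-Solver.solve-∀

  weight-identity : ∀ p d a₁ a₀ → (p + d) * (2 * a₁ + 3 * a₀) + d * a₁ ≡ (2 * p + 3 * d) * (a₁ + a₀) + p * a₀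
  weight-identity = ℕ-Solver.solve-∀

  weights-≤ : ∀ {p d a₁ a₀} → p * a₀ ≤ d * a₁ → (p + d) * (2 * a₁ + 3 * a₀) ≤ (2 * p + 3 * d) * (a₁ + a₀)
  weights-≤ {p} {d} {a₁} {a₀} pa₀≤da₁ = +-cancelʳ-≤ (d * a₁) _ _ (begin
    (p + d) * (2 * a₁ + 3 * a₀) + d * a₁   ≡⟨ weight-identity p d a₁ a₀ ⟩
    (2 * p + 3 * d) * (a₁ + a₀) + p * a₀   ≤⟨ +-monoʳ-≤ ((2 * p + 3 * d) * (a₁ + a₀)) pa₀≤da₁ ⟩
    (2 * p + 3 * d) * (a₁ + a₀) + d * a₁   ∎)
    where open ≤-Reasoning

  weights-≥ : ∀ {p d a₁ a₀} → d * a₁ ≤ p * a₀ → (2 * p + 3 * d) * (a₁ + a₀) ≤ (p + d) * (2 * a₁ + 3 * a₀)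
  weights-≥ {p} {d} {a₁} {a₀} da₁≤pa₀ = +-cancelʳ-≤ (p * a₀) _ _ (begin
    (2 * p + 3 * d) * (a₁ + a₀) + p * a₀   ≡⟨ weight-identity p d a₁ a₀ ⟨
    (p + d) * (2 * a₁ + 3 * a₀) + d * a₁   ≤⟨ +-monoʳ-≤ ((p + d) * (2 * a₁ + 3 * a₀)) da₁≤pa₀ ⟩
    (p + d) * (2 * a₁ + 3 * a₀) + p * a₀   ∎)
    where open ≤-Reasoning

  kA-increment : ∀ e k a₁ a₀ s → e * (3 + k) * (a₁ + a₀) + s
                                 ≡ (e * (1 + k) * a₁ + e * k * a₀) + s + e * (2 * a₁ + 3 * a₀)
  kA-increment = ℕ-Solver.solve-∀

  B-increment : ∀ c a₁ a₀ b₁ b₀ t → t + (c * b₁ + c * b₀) + c * (a₁ + a₀) ≡ c * ((b₁ + a₁) + (b₀ + a₀)) + t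
  B-increment = ℕ-Solver.solve-∀

  B-lower : ∀ {p d} → BelowPlastic p d →
            ∃ λ K → Eventually (λ k → (p + d) * k * A k ≤ (2 * p + 3 * d) * B k + K * A k)
  B-lower {p} {d} below = dominated-eventually (λ k → (2 * p + 3 * d) * B k) (λ k → (p + d) * k * A k)
                                                (Eventually-map slower (A-ratio-above {p} {d} below))
    where
    slower : ∀ k → p * A k ≤ d * A (suc k) →
             (p + d) * (3 + k) * A (3 + k) + ((2 * p + 3 * d) * B (1 + k) + (2 * p + 3 * d) * B k)
             ≤ (2 * p + 3 * d) * B (3 + k) + ((p + d) * (1 + k) * A (1 + k) + (p + d) * k * A k)
    slower k ratio = begin
      (p + d) * (3 + k) * A (3 + k) + cB
        ≡⟨ kA-increment (p + d) k (A (1 + k)) (A k) cB ⟩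
      kA + cB + (p + d) * (2 * A (1 + k) + 3 * A k)
        ≤⟨ +-monoʳ-≤ (kA + cB) (weights-≤ {p} {d} ratio) ⟩
      kA + cB + c * (A (1 + k) + A k)
        ≡⟨ B-increment c (A (1 + k)) (A k) (B (1 + k)) (B k) kA ⟩
      c * B (3 + k) + kA ∎
      where
      open ≤-Reasoning
      c = 2 * p + 3 * d
      kA = (p + d) * (1 + k) * A (1 + k) + (p + d) * k * A k
      cB = c * B (1 + k) + c * B k

  B-upper : ∀ {p d} → AbovePlastic p d →
            ∃ λ K → Eventually (λ k → (2 * p + 3 * d) * B k ≤ (p + d) * k * A k + K * A k)
  B-upper {p} {d} above = dominated-eventually (λ k → (p + d) * k * A k) (λ k → (2 * p + 3 * d) * B k)
                                                (Eventually-map slower (A-ratio-below {p} {d} above))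
    where
    slower : ∀ k → d * A (suc k) ≤ p * A k →
             (2 * p + 3 * d) * B (3 + k) + ((p + d) * (1 + k) * A (1 + k) + (p + d) * k * A k)
             ≤ (p + d) * (3 + k) * A (3 + k) + ((2 * p + 3 * d) * B (1 + k) + (2 * p + 3 * d) * B k)
    slower k ratio = begin
      c * B (3 + k) + kA
        ≡⟨ B-increment c (A (1 + k)) (A k) (B (1 + k)) (B k) kA ⟨
      kA + cB + c * (A (1 + k) + A k)
        ≤⟨ +-monoʳ-≤ (kA + cB) (weights-≥ {p} {d} ratio) ⟩
      kA + cB + (p + d) * (2 * A (1 + k) + 3 * A k)
        ≡⟨ kA-increment (p + d) k (A (1 + k)) (A k) cB ⟨
      (p + d) * (3 + k) * A (3 + k) + cB ∎
      where
      open ≤-Reasoning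
      c = 2 * p + 3 * d
      kA = (p + d) * (1 + k) * A (1 + k) + (p + d) * k * A k
      cB = c * B (1 + k) + c * B k

  BelowPlastic⇒0<d : ∀ {p d} → BelowPlastic p d → 0 < d
  BelowPlastic⇒0<d {p} {zero}  below = contradiction (subst (p * p * p <_) (trans (+-identityʳ (p * 0)) (*-zeroʳ p)) below) n≮0
  BelowPlastic⇒0<d {d = suc d} _     = z<s

  AbovePlastic⇒0<p : ∀ {p d} → AbovePlastic p d → 0 < p
  AbovePlastic⇒0<p {zero}  above = contradiction above n≮0
  AbovePlastic⇒0<p {suc p} _     = z<s

  lower-order< : ∀ {k} a b → k ≡ 2 + a + b → a * (k * k) + b * k + 1 < k * k * k
  lower-order< {k} a b refl = begin-strict
    a * (k * k) + b * k + 1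
      <⟨ +-mono-≤-< (+-monoʳ-≤ (a * (k * k)) (*-monoʳ-≤ b (m≤m*n k k))) (*-monoʳ-≤ 2 {1} {k * k} (s≤s z≤n)) ⟩
    a * (k * k) + b * (k * k) + 2 * (k * k) ≡⟨ regroup a b ⟩
    k * k * k                          ∎
    where
    open ≤-Reasoning
    regroup : ∀ a b → let k = 2 + a + b in a * (k * k) + b * (k * k) + 2 * (k * k) ≡ k * k * k
    regroup = ℕ-Solver.solve-∀

  between-below : ∀ {p₀ d₀} → BelowPlastic p₀ d₀ → ∃₂ λ p d → p₀ * d < p * d₀ × BelowPlastic p d
  between-below {p₀} {d₀} below = p₀ * k + 1 , d₀ * k , closer , still-below
    where
    open ≤-Reasoning
    k = 2 + 3 * (p₀ * p₀) + 3 * p₀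
    closer : p₀ * (d₀ * k) < (p₀ * k + 1) * d₀
    closer = begin-strict
      p₀ * (d₀ * k)       <⟨ m<m+n (p₀ * (d₀ * k)) (BelowPlastic⇒0<d {p₀} {d₀} below) ⟩
      p₀ * (d₀ * k) + d₀  ≡⟨ regroup p₀ d₀ k ⟩
      (p₀ * k + 1) * d₀   ∎
      where
      regroup : ∀ p₀ d₀ k → p₀ * (d₀ * k) + d₀ ≡ (p₀ * k + 1) * d₀
      regroup = ℕ-Solver.solve-∀
    still-below : BelowPlastic (p₀ * k + 1) (d₀ * k)
    still-below = begin-strict
      (p₀ * k + 1) * (p₀ * k + 1) * (p₀ * k + 1)
        ≡⟨ expand p₀ k ⟩
      p₀ * p₀ * p₀ * (k * k * k) + (3 * (p₀ * p₀) * (k * k) + 3 * p₀ * k + 1)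
        <⟨ +-monoʳ-< (p₀ * p₀ * p₀ * (k * k * k)) (lower-order< (3 * (p₀ * p₀)) (3 * p₀) refl) ⟩
      p₀ * p₀ * p₀ * (k * k * k) + k * k * k
        ≡⟨ +-comm (p₀ * p₀ * p₀ * (k * k * k)) (k * k * k) ⟩
      (1 + p₀ * p₀ * p₀) * (k * k * k)
        ≤⟨ *-monoˡ-≤ (k * k * k) below ⟩
      (p₀ * (d₀ * d₀) + d₀ * d₀ * d₀) * (k * k * k)
        ≤⟨ m≤m+n _ ((d₀ * k) * (d₀ * k)) ⟩
      (p₀ * (d₀ * d₀) + d₀ * d₀ * d₀) * (k * k * k) + (d₀ * k) * (d₀ * k)
        ≡⟨ regroup p₀ d₀ k ⟩
      (p₀ * k + 1) * ((d₀ * k) * (d₀ * k)) + (d₀ * k) * (d₀ * k) * (d₀ * k) ∎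
      where
      expand : ∀ p₀ k → (p₀ * k + 1) * (p₀ * k + 1) * (p₀ * k + 1)
                        ≡ p₀ * p₀ * p₀ * (k * k * k) + (3 * (p₀ * p₀) * (k * k) + 3 * p₀ * k + 1)
      expand = ℕ-Solver.solve-∀
      regroup : ∀ p₀ d₀ k → (p₀ * (d₀ * d₀) + d₀ * d₀ * d₀) * (k * k * k) + (d₀ * k) * (d₀ * k)
                            ≡ (p₀ * k + 1) * ((d₀ * k) * (d₀ * k)) + (d₀ * k) * (d₀ * k) * (d₀ * k)
      regroup = ℕ-Solver.solve-∀

  between-above : ∀ {p₁ d₁} → AbovePlastic p₁ d₁ → ∃₂ λ p d → p * d₁ < p₁ * d × AbovePlastic p d
  between-above {p₁} {d₁} above = p₁ * k , d₁ * k + 1 , closer , still-above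
    where
    open ≤-Reasoning
    k = 2 + (2 * p₁ * d₁ + 3 * (d₁ * d₁)) + (p₁ + 3 * d₁)
    closer : p₁ * k * d₁ < p₁ * (d₁ * k + 1)
    closer = begin-strict
      p₁ * k * d₁        <⟨ m<m+n (p₁ * k * d₁) (AbovePlastic⇒0<p {p₁} {d₁} above) ⟩
      p₁ * k * d₁ + p₁   ≡⟨ regroup p₁ d₁ k ⟩
      p₁ * (d₁ * k + 1)  ∎
      where
      regroup : ∀ p₁ d₁ k → p₁ * k * d₁ + p₁ ≡ p₁ * (d₁ * k + 1)
      regroup = ℕ-Solver.solve-∀
    still-above : AbovePlastic (p₁ * k) (d₁ * k + 1)
    still-above = begin-strict
      p₁ * k * ((d₁ * k + 1) * (d₁ * k + 1)) + (d₁ * k + 1) * (d₁ * k + 1) * (d₁ * k + 1)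
        ≡⟨ expand p₁ d₁ k ⟩
      (p₁ * (d₁ * d₁) + d₁ * d₁ * d₁) * (k * k * k)
        + ((2 * p₁ * d₁ + 3 * (d₁ * d₁)) * (k * k) + (p₁ + 3 * d₁) * k + 1)
        <⟨ +-monoʳ-< ((p₁ * (d₁ * d₁) + d₁ * d₁ * d₁) * (k * k * k))
                     (lower-order< (2 * p₁ * d₁ + 3 * (d₁ * d₁)) (p₁ + 3 * d₁) refl) ⟩
      (p₁ * (d₁ * d₁) + d₁ * d₁ * d₁) * (k * k * k) + k * k * k
        ≡⟨ +-comm ((p₁ * (d₁ * d₁) + d₁ * d₁ * d₁) * (k * k * k)) (k * k * k) ⟩
      (1 + (p₁ * (d₁ * d₁) + d₁ * d₁ * d₁)) * (k * k * k)
        ≤⟨ *-monoˡ-≤ (k * k * k) above ⟩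
      p₁ * p₁ * p₁ * (k * k * k)
        ≡⟨ regroup p₁ k ⟩
      p₁ * k * (p₁ * k) * (p₁ * k) ∎
      where
      expand : ∀ p₁ d₁ k → p₁ * k * ((d₁ * k + 1) * (d₁ * k + 1)) + (d₁ * k + 1) * (d₁ * k + 1) * (d₁ * k + 1)
                           ≡ (p₁ * (d₁ * d₁) + d₁ * d₁ * d₁) * (k * k * k)
                             + ((2 * p₁ * d₁ + 3 * (d₁ * d₁)) * (k * k) + (p₁ + 3 * d₁) * k + 1)
      expand = ℕ-Solver.solve-∀
      regroup : ∀ p₁ k → p₁ * p₁ * p₁ * (k * k * k) ≡ p₁ * k * (p₁ * k) * (p₁ * k)
      regroup = ℕ-Solver.solve-∀

  -- p / d ↦ (p + d) / (2 p + 3 d) is increasing, in cross-multiplied form.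
  weight-mono : ∀ {p₀ d₀ p d} → p₀ * d < p * d₀ → (p₀ + d₀) * (2 * p + 3 * d) < (p + d) * (2 * p₀ + 3 * d₀)
  weight-mono {p₀} {d₀} {p} {d} p₀d<pd₀ = +-cancelʳ-< (p * d₀) _ _ (begin-strict
    (p₀ + d₀) * (2 * p + 3 * d) + p * d₀    ≡⟨ cross p₀ d₀ p d ⟩
    (p + d) * (2 * p₀ + 3 * d₀) + p₀ * d    <⟨ +-monoʳ-< ((p + d) * (2 * p₀ + 3 * d₀)) p₀d<pd₀ ⟩
    (p + d) * (2 * p₀ + 3 * d₀) + p * d₀    ∎)
    where
    open ≤-Reasoning
    cross : ∀ p₀ d₀ p d → (p₀ + d₀) * (2 * p + 3 * d) + p * d₀ ≡ (p + d) * (2 * p₀ + 3 * d₀) + p₀ * d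
    cross = ℕ-Solver.solve-∀

  -- In fractions: e m a ≤ c b + K a says b / (m a) ≥ e / c - K / (c m), and e / c > e₀ / c₀; once m
  -- is large the gap survives replacing m by v ≤ 1 + m.
  squeeze-below : ∀ {e₀ c₀ e c K m a b v} → 0 < a → 0 < c → e₀ * c < e * c₀ → e₀ * c + K * c₀ < m →
                  e * m * a ≤ c * b + K * a → v ≤ 1 + m → e₀ * v * a < b * c₀
  squeeze-below {e₀} {c₀} {e} {c} {K} {m} {a} {b} {v} 0<a 0<c e₀c<ec₀ large em≤cb v≤1+m =
    *-cancelˡ-< c (e₀ * v * a) (b * c₀) (+-cancelʳ-< (K * c₀ * a) _ _ (begin-strict
      c * (e₀ * v * a) + K * c₀ * a               ≤⟨ +-monoˡ-≤ (K * c₀ * a) (≤-reflexive (regroup₁ c e₀ v a)) ⟩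
      (e₀ * c) * v * a + K * c₀ * a               ≤⟨ +-monoˡ-≤ (K * c₀ * a) (*-monoˡ-≤ a (*-monoʳ-≤ (e₀ * c) v≤1+m)) ⟩
      (e₀ * c) * (1 + m) * a + K * c₀ * a         ≡⟨ regroup₂ (e₀ * c) m a K c₀ ⟩
      ((e₀ * c) * m + (e₀ * c + K * c₀)) * a      <⟨ *-monoˡ-< a {{>-nonZero 0<a}} (+-monoʳ-< ((e₀ * c) * m) large) ⟩
      ((e₀ * c) * m + m) * a                      ≡⟨ cong (_* a) (+-comm ((e₀ * c) * m) m) ⟩
      (1 + e₀ * c) * m * a                        ≤⟨ *-monoˡ-≤ a (*-monoˡ-≤ m e₀c<ec₀) ⟩
      e * c₀ * m * a                              ≡⟨ regroup₃ e c₀ m a ⟩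
      c₀ * (e * m * a)                            ≤⟨ *-monoʳ-≤ c₀ em≤cb ⟩
      c₀ * (c * b + K * a)                        ≡⟨ regroup₄ c₀ c b K a ⟩
      c * (b * c₀) + K * c₀ * a                   ∎))
    where
    open ≤-Reasoning
    instance _ = >-nonZero 0<c
    regroup₁ : ∀ c e₀ v a → c * (e₀ * v * a) ≡ e₀ * c * v * a
    regroup₁ = ℕ-Solver.solve-∀
    regroup₂ : ∀ x m a K c₀ → x * (1 + m) * a + K * c₀ * a ≡ (x * m + (x + K * c₀)) * a
    regroup₂ = ℕ-Solver.solve-∀
    regroup₃ : ∀ e c₀ m a → e * c₀ * m * a ≡ c₀ * (e * m * a)
    regroup₃ = ℕ-Solver.solve-∀
    regroup₄ : ∀ c₀ c b K a → c₀ * (c * b + K * a) ≡ c * (b * c₀) + K * c₀ * a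
    regroup₄ = ℕ-Solver.solve-∀

  squeeze-above : ∀ {e₁ c₁ e c K m a b v} → 0 < a → 0 < c → e * c₁ < e₁ * c → c₁ * K < m →
                  c * b ≤ e * m * a + K * a → m ≤ v → b * c₁ < e₁ * v * a
  squeeze-above {e₁} {c₁} {e} {c} {K} {m} {a} {b} {v} 0<a 0<c ec₁<e₁c large cb≤em m≤v =
    *-cancelˡ-< c (b * c₁) (e₁ * v * a) (begin-strict
      c * (b * c₁)                      ≡⟨ regroup₁ c b c₁ ⟩
      c₁ * (c * b)                      ≤⟨ *-monoʳ-≤ c₁ cb≤em ⟩
      c₁ * (e * m * a + K * a)          ≡⟨ regroup₂ c₁ e m a K ⟩
      e * c₁ * m * a + c₁ * K * a       <⟨ +-monoʳ-< (e * c₁ * m * a) (*-monoˡ-< a {{>-nonZero 0<a}} large) ⟩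
      e * c₁ * m * a + m * a            ≡⟨ regroup₃ (e * c₁) m a ⟩
      (1 + e * c₁) * m * a              ≤⟨ *-monoˡ-≤ a (*-mono-≤ ec₁<e₁c m≤v) ⟩
      e₁ * c * v * a                    ≡⟨ regroup₄ e₁ c v a ⟩
      c * (e₁ * v * a)                  ∎)
    where
    open ≤-Reasoning
    regroup₁ : ∀ c b c₁ → c * (b * c₁) ≡ c₁ * (c * b)
    regroup₁ = ℕ-Solver.solve-∀
    regroup₂ : ∀ c₁ e m a K → c₁ * (e * m * a + K * a) ≡ e * c₁ * m * a + c₁ * K * a
    regroup₂ = ℕ-Solver.solve-∀
    regroup₃ : ∀ x m a → x * m * a + m * a ≡ (1 + x) * m * a
    regroup₃ = ℕ-Solver.solve-∀
    regroup₄ : ∀ e₁ c v a → e₁ * c * v * a ≡ c * (e₁ * v * a)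
    regroup₄ = ℕ-Solver.solve-∀

  n≤⌈n/2⌉+⌈n/2⌉ : ∀ n → n ≤ ⌈ n /2⌉ + ⌈ n /2⌉
  n≤⌈n/2⌉+⌈n/2⌉ n = subst (_≤ ⌈ n /2⌉ + ⌈ n /2⌉) (⌊n/2⌋+⌈n/2⌉≡n n) (+-monoˡ-≤ ⌈ n /2⌉ (⌊n/2⌋≤⌈n/2⌉ n))

  ⌈n/2⌉+⌈n/2⌉≤1+n : ∀ n → ⌈ n /2⌉ + ⌈ n /2⌉ ≤ 1 + n
  ⌈n/2⌉+⌈n/2⌉≤1+n n = subst (⌈ n /2⌉ + ⌈ n /2⌉ ≤_) (⌊n/2⌋+⌈n/2⌉≡n (suc n)) (+-monoʳ-≤ ⌈ n /2⌉ (⌈n/2⌉-mono (n≤1+n n)))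

  B/νA-above : ∀ {p₀ d₀} → BelowPlastic p₀ d₀ →
                 Eventually (λ m → (2 * p₀ + 2 * d₀) * (⌈ m /2⌉ * A m) < B m * (2 * p₀ + 3 * d₀))
  B/νA-above {p₀} {d₀} below₀ =
    let p , d , p₀/d₀<p/d , below = between-below {p₀} {d₀} below₀
        K , N , bound = B-lower {p} {d} below
        0<c = ≤-trans (BelowPlastic⇒0<d {p} {d} below) (≤-trans (m≤n*m d 3) (m≤n+m (3 * d) (2 * p)))
    in N + suc ((p₀ + d₀) * (2 * p + 3 * d) + K * (2 * p₀ + 3 * d₀)) , λ m large →
       subst (_< B m * (2 * p₀ + 3 * d₀)) (regroup p₀ d₀ ⌈ m /2⌉ (A m))
             (squeeze-below {p₀ + d₀} {2 * p₀ + 3 * d₀} {p + d} {2 * p + 3 * d} {K} {m} {A m} {B m} {⌈ m /2⌉ + ⌈ m /2⌉}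
                            (A-positive m) 0<c (weight-mono {p₀} {d₀} {p} {d} p₀/d₀<p/d) (m+n≤o⇒n≤o N large)
                            (bound m (m+n≤o⇒m≤o N large)) (⌈n/2⌉+⌈n/2⌉≤1+n m))
    where
    regroup : ∀ p₀ d₀ v a → (p₀ + d₀) * (v + v) * a ≡ (2 * p₀ + 2 * d₀) * (v * a)
    regroup = ℕ-Solver.solve-∀

  B/νA-below : ∀ {p₁ d₁} → AbovePlastic p₁ d₁ →
                 Eventually (λ m → B m * (2 * p₁ + 3 * d₁) < (2 * p₁ + 2 * d₁) * (⌈ m /2⌉ * A m))
  B/νA-below {p₁} {d₁} above₁ =
    let p , d , p/d<p₁/d₁ , above = between-above {p₁} {d₁} above₁
        K , N , bound = B-upper {p} {d} above
        0<c = ≤-trans (AbovePlastic⇒0<p {p} {d} above) (≤-trans (m≤n*m p 2) (m≤m+n (2 * p) (3 * d)))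
    in N + suc ((2 * p₁ + 3 * d₁) * K) , λ m large →
       subst (B m * (2 * p₁ + 3 * d₁) <_) (regroup p₁ d₁ ⌈ m /2⌉ (A m))
             (squeeze-above {p₁ + d₁} {2 * p₁ + 3 * d₁} {p + d} {2 * p + 3 * d} {K} {m} {A m} {B m} {⌈ m /2⌉ + ⌈ m /2⌉}
                            (A-positive m) 0<c (weight-mono {p} {d} {p₁} {d₁} p/d<p₁/d₁) (m+n≤o⇒n≤o N large)
                            (bound m (m+n≤o⇒m≤o N large)) (n≤⌈n/2⌉+⌈n/2⌉ m))
    where
    regroup : ∀ p₁ d₁ v a → (p₁ + d₁) * (v + v) * a ≡ (2 * p₁ + 2 * d₁) * (v * a)
    regroup = ℕ-Solver.solve-∀

module RationalBridge where

  open import Defs using (limitMap; _÷'_)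
  open PadovanRatio using (BelowPlastic; AbovePlastic)
  open import Data.Nat as ℕ using (ℕ; suc)
  import Data.Nat.Properties as ℕ
  open import Data.Integer as ℤ using (+_; -[1+_]; +<+)
  import Data.Integer.Properties as ℤ
  open import Data.Integer.Tactic.RingSolver as ℤ-Solver using ()
  open import Data.Nat.Coprimality using (Coprime)
  open import Data.Rational as ℚ using (ℚ; mkℚ; 0ℚ; 1ℚ; toℚᵘ)
  import Data.Rational.Properties as ℚ
  open import Data.Rational.Unnormalised as ℚᵘ using (mkℚᵘ; *<*; _≃_)
  import Data.Rational.Unnormalised.Properties as ℚᵘ
  open import Data.Sum using (inj₁; inj₂)
  open import Relation.Binary.PropositionalEquality
  open import Relation.Nullary using (¬_; yes; no; contradiction)

  toℚᵘ-mono-≃ : ∀ {u v U V} → toℚᵘ u ≃ U → toℚᵘ v ≃ V → u ℚ.< v → U ℚᵘ.< V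
  toℚᵘ-mono-≃ u≃U v≃V u<v = ℚᵘ.<-respʳ-≃ v≃V (ℚᵘ.<-respˡ-≃ u≃U (ℚ.toℚᵘ-mono-< u<v))

  toℚᵘ-cancel-≃ : ∀ {u v U V} → toℚᵘ u ≃ U → toℚᵘ v ≃ V → U ℚᵘ.< V → u ℚ.< v
  toℚᵘ-cancel-≃ u≃U v≃V U<V = ℚ.toℚᵘ-cancel-< (ℚᵘ.<-respʳ-≃ (ℚᵘ.≃-sym v≃V) (ℚᵘ.<-respˡ-≃ (ℚᵘ.≃-sym u≃U) U<V))

  toℚᵘ-cube : ∀ s → toℚᵘ (s ℚ.* s ℚ.* s) ≃ toℚᵘ s ℚᵘ.* toℚᵘ s ℚᵘ.* toℚᵘ s
  toℚᵘ-cube s = ℚᵘ.≃-trans (ℚ.toℚᵘ-homo-* (s ℚ.* s) s) (ℚᵘ.*-congʳ (ℚ.toℚᵘ-homo-* s s))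

  cast-cube : ∀ n → + (n ℕ.* n ℕ.* n) ≡ + n ℤ.* + n ℤ.* + n
  cast-cube n = trans (ℤ.pos-* (n ℕ.* n) n) (cong (ℤ._* + n) (ℤ.pos-* n n))

  cast-mixed : ∀ p d → + (p ℕ.* (d ℕ.* d) ℕ.+ d ℕ.* d ℕ.* d) ≡ + p ℤ.* (+ d ℤ.* + d) ℤ.+ + d ℤ.* + d ℤ.* + d
  cast-mixed p d = trans (ℤ.pos-+ (p ℕ.* (d ℕ.* d)) (d ℕ.* d ℕ.* d))
                         (cong₂ ℤ._+_ (trans (ℤ.pos-* p (d ℕ.* d)) (cong (+ p ℤ.*_) (ℤ.pos-* d d))) (cast-cube d))

  cast-lin : ∀ a b c e → + (a ℕ.* b ℕ.+ c ℕ.* e) ≡ + a ℤ.* + b ℤ.+ + c ℤ.* + e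
  cast-lin a b c e = trans (ℤ.pos-+ (a ℕ.* b) (c ℕ.* e)) (cong₂ ℤ._+_ (ℤ.pos-* a b) (ℤ.pos-* c e))

  module _ {p dm : ℕ} .{c : Coprime p (suc dm)} where
    private
      s = mkℚ (+ p) dm c
      d = suc dm
      -- The sides of the inequalities unpacked from *<* below are, definitionally, these
      -- cross-multiplied ℤ expressions in the numerator and denominator of s.
      cube : ∀ P D → P ℤ.* P ℤ.* P ℤ.* (D ℤ.* + 1) ≡ P ℤ.* P ℤ.* P ℤ.* D
      cube = ℤ-Solver.solve-∀
      mixed : ∀ P D → (P ℤ.* + 1 ℤ.+ + 1 ℤ.* D) ℤ.* (D ℤ.* D ℤ.* D) ≡ (P ℤ.* (D ℤ.* D) ℤ.+ D ℤ.* D ℤ.* D) ℤ.* D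
      mixed = ℤ-Solver.solve-∀

    cube<succ⇒BelowPlastic : s ℚ.* s ℚ.* s ℚ.< s ℚ.+ 1ℚ → BelowPlastic p d
    cube<succ⇒BelowPlastic s³<s+1 with toℚᵘ-mono-≃ (toℚᵘ-cube s) (ℚ.toℚᵘ-homo-+ s 1ℚ) s³<s+1
    ... | *<* cross = ℤ.drop‿+<+ (subst₂ ℤ._<_ (sym (cast-cube p)) (sym (cast-mixed p d))
                        (ℤ.*-cancelʳ-<-nonNeg (+ d) (subst₂ ℤ._<_ (cube (+ p) (+ d)) (mixed (+ p) (+ d)) cross)))

    succ<cube⇒AbovePlastic : s ℚ.+ 1ℚ ℚ.< s ℚ.* s ℚ.* s → AbovePlastic p d
    succ<cube⇒AbovePlastic s+1<s³ with toℚᵘ-mono-≃ (ℚ.toℚᵘ-homo-+ s 1ℚ) (toℚᵘ-cube s) s+1<s³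
    ... | *<* cross = ℤ.drop‿+<+ (subst₂ ℤ._<_ (sym (cast-mixed p d)) (sym (cast-cube p))
                        (ℤ.*-cancelʳ-<-nonNeg (+ d) (subst₂ ℤ._<_ (mixed (+ p) (+ d)) (cube (+ p) (+ d)) cross)))

  mixed≤cubes : ∀ x d → x ℕ.* (d ℕ.* d) ℕ.≤ d ℕ.* d ℕ.* d ℕ.+ x ℕ.* x ℕ.* x
  mixed≤cubes x d with ℕ.≤-total x d
  ... | inj₁ x≤d = ℕ.≤-trans (ℕ.≤-trans (ℕ.*-monoˡ-≤ (d ℕ.* d) x≤d) (ℕ.≤-reflexive (sym (ℕ.*-assoc d d d))))
                             (ℕ.m≤m+n (d ℕ.* d ℕ.* d) (x ℕ.* x ℕ.* x))
  ... | inj₂ d≤x = ℕ.≤-trans (ℕ.≤-trans (ℕ.*-monoʳ-≤ x (ℕ.*-mono-≤ d≤x d≤x)) (ℕ.≤-reflexive (sym (ℕ.*-assoc x x x))))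
                             (ℕ.m≤n+m (x ℕ.* x ℕ.* x) (d ℕ.* d ℕ.* d))

  module _ {n dm : ℕ} .{c : Coprime (suc n) (suc dm)} where
    private
      t = mkℚ -[1+ n ] dm c
      x = suc n
      d = suc dm

    negative-succ≮cube : ¬ (t ℚ.+ 1ℚ ℚ.< t ℚ.* t ℚ.* t)
    negative-succ≮cube t+1<t³ with toℚᵘ-mono-≃ (ℚ.toℚᵘ-homo-+ t 1ℚ) (toℚᵘ-cube t) t+1<t³
    ... | *<* cross = ℕ.<⇒≱ cubes<mixed (mixed≤cubes x d)
      where
      left : ∀ X D → ((ℤ.- X) ℤ.* + 1 ℤ.+ + 1 ℤ.* D) ℤ.* (D ℤ.* D ℤ.* D) ℤ.+ (X ℤ.* (D ℤ.* D ℤ.* D) ℤ.+ X ℤ.* X ℤ.* X ℤ.* D)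
                     ≡ (D ℤ.* D ℤ.* D ℤ.+ X ℤ.* X ℤ.* X) ℤ.* D
      left = ℤ-Solver.solve-∀
      right : ∀ X D → ((ℤ.- X) ℤ.* (ℤ.- X) ℤ.* (ℤ.- X)) ℤ.* (D ℤ.* + 1) ℤ.+ (X ℤ.* (D ℤ.* D ℤ.* D) ℤ.+ X ℤ.* X ℤ.* X ℤ.* D)
                      ≡ (X ℤ.* (D ℤ.* D)) ℤ.* D
      right = ℤ-Solver.solve-∀
      X = + x
      D = + d
      cubes<mixed : d ℕ.* d ℕ.* d ℕ.+ x ℕ.* x ℕ.* x ℕ.< x ℕ.* (d ℕ.* d)
      cubes<mixed = ℤ.drop‿+<+ (subst₂ ℤ._<_
        (sym (trans (ℤ.pos-+ (d ℕ.* d ℕ.* d) (x ℕ.* x ℕ.* x)) (cong₂ ℤ._+_ (cast-cube d) (cast-cube x))))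
        (sym (trans (ℤ.pos-* x (d ℕ.* d)) (cong (X ℤ.*_) (ℤ.pos-* d d))))
        (ℤ.*-cancelʳ-<-nonNeg D (subst₂ ℤ._<_ (left X D) (right X D)
          (ℤ.+-monoˡ-< (X ℤ.* (D ℤ.* D ℤ.* D) ℤ.+ X ℤ.* X ℤ.* X ℤ.* D) cross))))

  ÷'≡÷ : ∀ a b (0<b : 0ℚ ℚ.< b) → a ÷' b ≡ ℚ._÷_ a b {{ℚ.>-nonZero 0<b}}
  ÷'≡÷ a b 0<b with b ℚ.≟ 0ℚ
  ... | yes b≡0 = contradiction (sym b≡0) (ℚ.<⇒≢ 0<b)
  ... | no _    = refl

  ÷*-cancel : ∀ a b .{{_ : ℚ.NonZero b}} → ℚ._÷_ a b ℚ.* b ≡ a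
  ÷*-cancel a b = trans (ℚ.*-assoc a (ℚ.1/ b) b) (trans (cong (a ℚ.*_) (ℚ.*-inverseˡ b)) (ℚ.*-identityʳ a))

  ÷<⇐ : ∀ {a b z} (0<b : 0ℚ ℚ.< b) → a ℚ.< z ℚ.* b → ℚ._÷_ a b {{ℚ.>-nonZero 0<b}} ℚ.< z
  ÷<⇐ {a} {b} {z} 0<b a<zb = ℚ.*-cancelʳ-<-nonNeg b {{ℚ.nonNegative (ℚ.<⇒≤ 0<b)}}
    (subst (ℚ._< z ℚ.* b) (sym (÷*-cancel a b {{ℚ.>-nonZero 0<b}})) a<zb)

  <÷⇐ : ∀ {a b z} (0<b : 0ℚ ℚ.< b) → z ℚ.* b ℚ.< a → z ℚ.< ℚ._÷_ a b {{ℚ.>-nonZero 0<b}}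
  <÷⇐ {a} {b} {z} 0<b zb<a = ℚ.*-cancelʳ-<-nonNeg b {{ℚ.nonNegative (ℚ.<⇒≤ 0<b)}}
    (subst (z ℚ.* b ℚ.<_) (sym (÷*-cancel a b {{ℚ.>-nonZero 0<b}})) zb<a)

  module _ {p dm : ℕ} .{c : Coprime p (suc dm)} where
    private
      s = mkℚ (+ p) dm c
      d = suc dm
      P = + p
      D = + d
      num den : ℚ
      num = + 2 ℚ./ 1 ℚ.* s ℚ.+ + 2 ℚ./ 1
      den = + 2 ℚ./ 1 ℚ.* s ℚ.+ + 3 ℚ./ 1
      toℚᵘ-affine : ∀ e → toℚᵘ (+ 2 ℚ./ 1 ℚ.* s ℚ.+ e) ≃ mkℚᵘ (+ 2) 0 ℚᵘ.* mkℚᵘ P dm ℚᵘ.+ toℚᵘ e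
      toℚᵘ-affine e = ℚᵘ.≃-trans (ℚ.toℚᵘ-homo-+ (+ 2 ℚ./ 1 ℚ.* s) e)
                                 (ℚᵘ.+-congˡ (toℚᵘ e) (ℚ.toℚᵘ-homo-* (+ 2 ℚ./ 1) s))
      affine : ∀ c P D → (+ 2 ℤ.* P) ℤ.* + 1 ℤ.+ c ℤ.* (+ 1 ℤ.* D) ≡ + 2 ℤ.* P ℤ.+ c ℤ.* D
      affine = ℤ-Solver.solve-∀
      0<den : 0ℚ ℚ.< den
      0<den = toℚᵘ-cancel-≃ ℚᵘ.≃-refl (toℚᵘ-affine (+ 3 ℚ./ 1))
        (*<* (subst (ℤ.+0 ℤ.<_) (trans (cast-lin 2 p 3 d) (sym (trans (ℤ.*-identityʳ _) (affine (+ 3) P D))))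
                    (+<+ (ℕ.≤-trans (ℕ.s≤s ℕ.z≤n) (ℕ.m≤n+m (3 ℕ.* d) (2 ℕ.* p))))))
      toℚᵘ-fraction*den : ∀ T k → toℚᵘ (+ T ℚ./ suc k ℚ.* den)
                                  ≃ mkℚᵘ (+ T) k ℚᵘ.* (mkℚᵘ (+ 2) 0 ℚᵘ.* mkℚᵘ P dm ℚᵘ.+ mkℚᵘ (+ 3) 0)
      toℚᵘ-fraction*den T k = ℚᵘ.≃-trans (ℚ.toℚᵘ-homo-* (+ T ℚ./ suc k) den)
                                         (ℚᵘ.*-cong (ℚ.toℚᵘ-fromℚᵘ (mkℚᵘ (+ T) k)) (toℚᵘ-affine (+ 3 ℚ./ 1)))
      cast-num : ∀ k → + ((2 ℕ.* p ℕ.+ 2 ℕ.* d) ℕ.* suc k) ≡ (+ 2 ℤ.* P ℤ.+ + 2 ℤ.* D) ℤ.* + suc k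
      cast-num k = trans (ℤ.pos-* (2 ℕ.* p ℕ.+ 2 ℕ.* d) (suc k)) (cong (ℤ._* + suc k) (cast-lin 2 p 2 d))
      cast-den : ∀ T → + (T ℕ.* (2 ℕ.* p ℕ.+ 3 ℕ.* d)) ≡ + T ℤ.* (+ 2 ℤ.* P ℤ.+ + 3 ℤ.* D)
      cast-den T = trans (ℤ.pos-* T (2 ℕ.* p ℕ.+ 3 ℕ.* d)) (cong (+ T ℤ.*_) (cast-lin 2 p 3 d))
      num-cross : ∀ P D K → (+ 2 ℤ.* P ℤ.+ + 2 ℤ.* D) ℤ.* K ℤ.* D
                            ≡ ((+ 2 ℤ.* P) ℤ.* + 1 ℤ.+ + 2 ℤ.* (+ 1 ℤ.* D)) ℤ.* (K ℤ.* ((+ 1 ℤ.* D) ℤ.* + 1))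
      num-cross = ℤ-Solver.solve-∀
      den-cross : ∀ P D T → T ℤ.* (+ 2 ℤ.* P ℤ.+ + 3 ℤ.* D) ℤ.* D
                            ≡ (T ℤ.* ((+ 2 ℤ.* P) ℤ.* + 1 ℤ.+ + 3 ℤ.* (+ 1 ℤ.* D))) ℤ.* ((+ 1 ℤ.* D) ℤ.* + 1)
      den-cross = ℤ-Solver.solve-∀

    limitMap<fraction : ∀ {T k} → (2 ℕ.* p ℕ.+ 2 ℕ.* d) ℕ.* suc k ℕ.< T ℕ.* (2 ℕ.* p ℕ.+ 3 ℕ.* d) →
                        limitMap s ℚ.< + T ℚ./ suc k
    limitMap<fraction {T} {k} h = subst (ℚ._< + T ℚ./ suc k) (sym (÷'≡÷ num den 0<den))
      (÷<⇐ 0<den (toℚᵘ-cancel-≃ (toℚᵘ-affine (+ 2 ℚ./ 1)) (toℚᵘ-fraction*den T k)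
        (*<* (subst₂ ℤ._<_ (num-cross P D (+ suc k)) (den-cross P D (+ T))
               (ℤ.*-monoʳ-<-pos D (subst₂ ℤ._<_ (cast-num k) (cast-den T) (+<+ h)))))))

    fraction<limitMap : ∀ {T k} → T ℕ.* (2 ℕ.* p ℕ.+ 3 ℕ.* d) ℕ.< (2 ℕ.* p ℕ.+ 2 ℕ.* d) ℕ.* suc k →
                        + T ℚ./ suc k ℚ.< limitMap s
    fraction<limitMap {T} {k} h = subst (+ T ℚ./ suc k ℚ.<_) (sym (÷'≡÷ num den 0<den))
      (<÷⇐ 0<den (toℚᵘ-cancel-≃ (toℚᵘ-fraction*den T k) (toℚᵘ-affine (+ 2 ℚ./ 1))
        (*<* (subst₂ ℤ._<_ (den-cross P D (+ T)) (num-cross P D (+ suc k))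
               (ℤ.*-monoʳ-<-pos D (subst₂ ℤ._<_ (cast-den T) (cast-num k) (+<+ h)))))))

module PathIndex where

  open import Defs using (ℐ; ν; 𝒯₀; 𝒯₁; P; limitMap)
  open Padovan
  open PathMatchings using (𝒯₀-path; 𝒯₁-path; ν-path)
  open PadovanRatio using (A-positive; BelowPlastic; AbovePlastic; Eventually)
  open SizeAsymptotics using (B/νA-above; B/νA-below)
  open RationalBridge using (limitMap<fraction; fraction<limitMap)
  open import Data.Nat as ℕ using (ℕ; suc; ⌈_/2⌉; ⌊_/2⌋; s≤s)
  open import Data.Nat.Properties using (m≤n⇒m≤1+n)
  open import Data.Integer using (+_)
  open import Data.Nat.Coprimality using (Coprime)
  open import Data.Product using (∃; _×_; _,_)
  open import Data.Rational as ℚ using (mkℚ)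
  open import Relation.Binary.PropositionalEquality

  ℐ≡𝒯₁/ν𝒯₀ : ∀ G {v t} → ν G ≡ suc v → 𝒯₀ G ≡ suc t → ℐ G ≡ + 𝒯₁ G ℚ./ (suc v ℕ.* suc t)
  ℐ≡𝒯₁/ν𝒯₀ G _ _ with ν G | 𝒯₀ G
  ℐ≡𝒯₁/ν𝒯₀ G refl refl | _ | _ = refl

  ℐ-path : ∀ m → ∃ λ k → suc k ≡ ⌈ suc m /2⌉ ℕ.* A (suc m) × ℐ (P (2 ℕ.+ m)) ≡ + B (suc m) ℚ./ suc k
  ℐ-path m with A (suc m) | 𝒯₀-path (suc m) | A-positive (suc m)
  ... | suc t | 𝒯₀≡ | _ = t ℕ.+ ⌊ m /2⌋ ℕ.* suc t , refl ,
                          trans (ℐ≡𝒯₁/ν𝒯₀ (P (2 ℕ.+ m)) (ν-path (suc m)) 𝒯₀≡)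
                                (cong (λ T → + T ℚ./ suc (t ℕ.+ ⌊ m /2⌋ ℕ.* suc t)) (𝒯₁-path (suc m)))

  module _ {p dm : ℕ} .{c : Coprime p (suc dm)} where
    private
      s = mkℚ (+ p) dm c
      d = suc dm

    limitMap<ℐ : BelowPlastic p d → Eventually (λ n → limitMap s ℚ.< ℐ (P n))
    limitMap<ℐ below =
      let N , bound = B/νA-above {p} {d} below in
      2 ℕ.+ N , λ where
        (suc (suc m)) (s≤s (s≤s N≤m)) →
          let k , k≡ , ℐ≡ = ℐ-path m in
          subst (limitMap s ℚ.<_) (sym ℐ≡)
                (limitMap<fraction {p} {dm} {c} {B (suc m)} {k}
                   (subst (λ q → (2 ℕ.* p ℕ.+ 2 ℕ.* d) ℕ.* q ℕ.< B (suc m) ℕ.* (2 ℕ.* p ℕ.+ 3 ℕ.* d)) (sym k≡)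
                          (bound (suc m) (m≤n⇒m≤1+n N≤m))))

    ℐ<limitMap : AbovePlastic p d → Eventually (λ n → ℐ (P n) ℚ.< limitMap s)
    ℐ<limitMap above =
      let N , bound = B/νA-below {p} {d} above in
      2 ℕ.+ N , λ where
        (suc (suc m)) (s≤s (s≤s N≤m)) →
          let k , k≡ , ℐ≡ = ℐ-path m in
          subst (ℚ._< limitMap s) (sym ℐ≡)
                (fraction<limitMap {p} {dm} {c} {B (suc m)} {k}
                   (subst (λ q → B (suc m) ℕ.* (2 ℕ.* p ℕ.+ 3 ℕ.* d) ℕ.< (2 ℕ.* p ℕ.+ 2 ℕ.* d) ℕ.* q) (sym k≡)
                          (bound (suc m) (m≤n⇒m≤1+n N≤m))))

open import Defs
open import Data.Nat using (ℕ; _≥_)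
open import Data.Product using (∃; _×_)
open import Data.Rational using (ℚ; 0ℚ; 1ℚ; _<_; _≤_; _*_; _+_; mkℚ; *≤*)
open import Data.Integer using (+_; -[1+_])
open import Relation.Nullary using (contradiction)
open PadovanRatio using (Eventually-×)
open RationalBridge using (cube<succ⇒BelowPlastic; succ<cube⇒AbovePlastic; negative-succ≮cube)
open PathIndex using (limitMap<ℐ; ℐ<limitMap)

theorem2 : (s t : ℚ) → 0ℚ ≤ s → s * s * s < s + 1ℚ → t + 1ℚ < t * t * t →
           ∃ λ (N : ℕ) → (n : ℕ) → n ≥ N →
             (limitMap s < ℐ (P n)) × (ℐ (P n) < limitMap t)
theorem2 (mkℚ -[1+ _ ] _ _)   _                      (*≤* ()) _      _
theorem2 (mkℚ (+ _) _ _)      (mkℚ -[1+ n ] dm₁ c₁)  _        _      t+1<t³ =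
  contradiction t+1<t³ (negative-succ≮cube {n} {dm₁} {c₁})
theorem2 (mkℚ (+ p) dm₀ c₀)   (mkℚ (+ q) dm₁ c₁)     _        s³<s+1 t+1<t³ =
  Eventually-× (limitMap<ℐ {p} {dm₀} {c₀} (cube<succ⇒BelowPlastic {p} {dm₀} {c₀} s³<s+1))
               (ℐ<limitMap {q} {dm₁} {c₁} (succ<cube⇒AbovePlastic {q} {dm₁} {c₁} t+1<t³))
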